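{- Let $u=2^w$, let $A\subseteq[u]\setminus\{0\}$ with $|A|=n$, and let $m=2^{\lceil\log n\rceil}$. Let $T$ be a positive integer and $L$ a positive integer, and choose hash functions $h_0,\dots,h_{L-1}$ independently and uniformly at random from the family $\mathcal{H}_{u,m}=\{h_a : a\in[u]\text{ odd}\}$, where $h_a(x)=(ax \bmod u)\div (u/m)$. Then for each $x\in A$, the probability that $x$ is bad is at most $\exp\!\left(-\frac{2L}{3T}\right)$.
   Context: Here $[k]=\{0,\dots,k-1\}$ and $\div$ is integer division. The family $\mathcal{H}_{u,m}$ is 2-universal: for distinct $x,x'\in[u]$, $\Pr_h[h(x)=h(x')]\le 2/m$. For $i\in[L]$ and $j\in[m]$, $\mathrm{bucket}_i(j)=\{x\in A: h_i(x)=j\}$. If $|\mathrm{bucket}_i(j)|>T$, the elements of $\mathrm{bucket}_i(j)$ are said to be discarded by $h_i$ (the truncated bucket is empty); otherwise the bucket is kept. An element $x\in A$ is bad if it is discarded by at least a $4/T$ fraction of the $L$ hash functions $h_0,\dots,h_{L-1}$. -}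

module Defs where

open import Data.Nat as ℕ using (ℕ; zero; suc; _+_; _*_; _^_; _≤_; _<_; _<?_; _≤?_)
open import Data.Nat.Properties using (_≟_)
open import Data.List using (List; []; _∷_; length; filter; upTo; map; concatMap)
open import Data.Integer using (+_)
open import Data.Rational as ℚ using (ℚ)

-- Total natural-number division / remainder (junk value 0 for divisor 0;
-- never used with divisor 0 below, since all divisors are powers of 2).

divℕ : ℕ → ℕ → ℕ
divℕ a zero    = 0
divℕ a (suc b) = a ℕ./ suc b

modℕ : ℕ → ℕ → ℕ
modℕ a zero    = a
modℕ a (suc b) = a ℕ.% suc b

range : ℕ → List ℕ
range = upTo

hashH : (u m a x : ℕ) → ℕ
hashH u m a x = divℕ (modℕ (a * x) u) (divℕ u m)

-- the odd elements of [u]: the index set of H_{u,m}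
oddsBelow : ℕ → List ℕ
oddsBelow u = filter (λ a → a ℕ.% 2 ≟ 1) (range u)

-- all L-tuples (as lists) of elements of S: the sample space of L
-- independent uniform choices from S (uniform measure on this list)
tuples : ℕ → List ℕ → List (List ℕ)
tuples zero    S = [] ∷ []
tuples (suc L) S = concatMap (λ a → map (a ∷_) (tuples L S)) S

bucketSize : (u m : ℕ) (A : List ℕ) (a x : ℕ) → ℕ
bucketSize u m A a x = length (filter (λ y → hashH u m a y ≟ hashH u m a x) A)

discardCount : (u m T : ℕ) (A : List ℕ) (x : ℕ) (as : List ℕ) → ℕ
discardCount u m T A x as = length (filter (λ a → T <? bucketSize u m A a x) as)

-- x is bad: discarded by at least a 4/T fraction of the L hash functions,
-- i.e. discardCount ≥ (4/T)·L, i.e. 4·L ≤ T·discardCount (T > 0)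
Bad : (u m T L : ℕ) (A : List ℕ) (x : ℕ) (as : List ℕ) → Set
Bad u m T L A x as = 4 * L ≤ T * discardCount u m T A x as

badCount : (u m T L : ℕ) (A : List ℕ) (x : ℕ) → ℕ
badCount u m T L A x =
  length (filter (λ as → 4 * L ≤? T * discardCount u m T A x as) (tuples L (oddsBelow u)))

totalCount : (u L : ℕ) → ℕ
totalCount u L = length (tuples L (oddsBelow u))

ratℕ : ℕ → ℕ → ℚ
ratℕ a zero    = ℚ.0ℚ
ratℕ a (suc b) = (+ a) ℚ./ suc b

ofℕ : ℕ → ℚ
ofℕ a = ratℕ a 1

expTerm : ℚ → ℕ → ℚ
expTerm r zero    = ℚ.1ℚ
expTerm r (suc i) = expTerm r i ℚ.* r ℚ.* ratℕ 1 (suc i)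

expPartial : ℚ → ℕ → ℚ
expPartial r zero    = ℚ.0ℚ
expPartial r (suc K) = expPartial r K ℚ.+ expTerm r K

-- For p ≥ 0 and r ≥ 0:  p ≤ exp(-r)  ⇔  p · exp(r) ≤ 1
-- ⇔  p · Σ_{i<K} r^i/i! ≤ 1 for every K  (partial sums increase to exp r).
-- With p = num/den (den > 0) this is num · Σ_{i<K} r^i/i! ≤ den.
ProbLeExpNeg : (num den : ℕ) (r : ℚ) → Set
ProbLeExpNeg num den r = ∀ K → ofℕ num ℚ.* expPartial r K ℚ.≤ ofℕ den

module Submission where

-- Fix x ∈ A and write u = 2^w, N = u/2 for the number of odd multipliers. By 2-universality each other
-- y ∈ A shares the bucket of x under at most u/m multipliers, so by Markov's inequality at most
-- D ≤ 2N/T multipliers discard x. Weighting an L-tuple of multipliers by 2^(number of discarding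
-- entries), the total weight is (N + D)^L while a bad tuple weighs at least 2^(4L/T); hence
-- Pr[x bad] ≤ ((1 + 2/T)^T / 16)^(L/T) ≤ (1 − 2/(3T))^L ≤ exp(−2L/(3T)), the middle step being
-- (1 + 8/(3T − 2))^T ≤ 16.

open import Defs
open import Data.Nat as ℕ using (ℕ; zero; suc; _^_)
open import Relation.Binary.PropositionalEquality

module ExponentialSeries where

  import Data.Nat.Properties as ℕ
  import Data.Nat.Tactic.RingSolver as ℕ
  open import Data.Integer as ℤ using ()
  import Data.Integer.Properties as ℤ
  import Data.Integer.Tactic.RingSolver as ℤ
  open import Data.Rational as ℚ using (ℚ; 0ℚ; 1ℚ; _+_; _*_; _≤_; toℚᵘ)
  open import Data.Rational.Properties
  import Data.Rational.Unnormalised as ℚᵘ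
  import Data.Rational.Unnormalised.Properties as ℚᵘ
  open import Data.Rational.Solver using (module +-*-Solver)
  open +-*-Solver using (solve; _:+_; _:*_; :-_; _:=_; con)
  open import Data.Unit using (tt)
  open import Data.Sum using (inj₁; inj₂)
  open import Data.List using (upTo)
  import Data.List.Relation.Unary.All as All
  open import Data.List.Membership.Propositional.Properties using (∈-upTo⁺)
  open import Relation.Nullary using (Dec; yes; no)
  open import Relation.Nullary.Decidable using (toWitness)
  open ≤-Reasoning

  private
    toℚᵘ-ratℕ : ∀ a d → toℚᵘ (ratℕ a (suc d)) ℚᵘ.≃ ℚᵘ.mkℚᵘ (ℤ.+ a) d
    toℚᵘ-ratℕ a d = toℚᵘ-fromℚᵘ (ℚᵘ.mkℚᵘ (ℤ.+ a) d)

  ofℕ-+ : ∀ a b → ofℕ (a ℕ.+ b) ≡ ofℕ a + ofℕ b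
  ofℕ-+ a b = toℚᵘ-injective (ℚᵘ.≃-trans (toℚᵘ-ratℕ (a ℕ.+ b) 0) (ℚᵘ.≃-trans a+b≃
    (ℚᵘ.≃-sym (ℚᵘ.≃-trans (toℚᵘ-homo-+ (ofℕ a) (ofℕ b)) (ℚᵘ.+-cong (toℚᵘ-ratℕ a 0) (toℚᵘ-ratℕ b 0))))))
    where
    a+b≃ : ℚᵘ.mkℚᵘ (ℤ.+ (a ℕ.+ b)) 0 ℚᵘ.≃ ℚᵘ.mkℚᵘ (ℤ.+ a) 0 ℚᵘ.+ ℚᵘ.mkℚᵘ (ℤ.+ b) 0
    a+b≃ = ℚᵘ.*≡* (trans (cong (ℤ._* ℤ.1ℤ) (ℤ.pos-+ a b)) (normalise (ℤ.+ a) (ℤ.+ b)))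
      where
      normalise : ∀ (x y : ℤ.ℤ) → (x ℤ.+ y) ℤ.* ℤ.1ℤ ≡ (x ℤ.* ℤ.1ℤ ℤ.+ y ℤ.* ℤ.1ℤ) ℤ.* ℤ.1ℤ
      normalise = ℤ.solve-∀

  ofℕ-* : ∀ a b → ofℕ (a ℕ.* b) ≡ ofℕ a * ofℕ b
  ofℕ-* a b = toℚᵘ-injective (ℚᵘ.≃-trans (toℚᵘ-ratℕ (a ℕ.* b) 0) (ℚᵘ.≃-trans a*b≃
    (ℚᵘ.≃-sym (ℚᵘ.≃-trans (toℚᵘ-homo-* (ofℕ a) (ofℕ b)) (ℚᵘ.*-cong (toℚᵘ-ratℕ a 0) (toℚᵘ-ratℕ b 0))))))
    where
    a*b≃ : ℚᵘ.mkℚᵘ (ℤ.+ (a ℕ.* b)) 0 ℚᵘ.≃ ℚᵘ.mkℚᵘ (ℤ.+ a) 0 ℚᵘ.* ℚᵘ.mkℚᵘ (ℤ.+ b) 0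
    a*b≃ = ℚᵘ.*≡* (trans (cong (ℤ._* ℤ.1ℤ) (ℤ.pos-* a b)) (normalise (ℤ.+ a) (ℤ.+ b)))
      where
      normalise : ∀ (x y : ℤ.ℤ) → (x ℤ.* y) ℤ.* ℤ.1ℤ ≡ (x ℤ.* y) ℤ.* (ℤ.1ℤ ℤ.* ℤ.1ℤ)
      normalise = ℤ.solve-∀

  ratℕ-*-ofℕ : ∀ k d → ratℕ k (suc d) * ofℕ (suc d) ≡ ofℕ k
  ratℕ-*-ofℕ k d = toℚᵘ-injective (ℚᵘ.≃-trans (toℚᵘ-homo-* (ratℕ k (suc d)) (ofℕ (suc d)))
    (ℚᵘ.≃-trans (ℚᵘ.*-cong (toℚᵘ-ratℕ k d) (toℚᵘ-ratℕ (suc d) 0)) (ℚᵘ.≃-trans k/d*d≃k (ℚᵘ.≃-sym (toℚᵘ-ratℕ k 0)))))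
    where
    k/d*d≃k : ℚᵘ.mkℚᵘ (ℤ.+ k) d ℚᵘ.* ℚᵘ.mkℚᵘ (ℤ.+ suc d) 0 ℚᵘ.≃ ℚᵘ.mkℚᵘ (ℤ.+ k) 0
    k/d*d≃k = ℚᵘ.*≡* (normalise (ℤ.+ k) (ℤ.+ suc d))
      where
      normalise : ∀ (x y : ℤ.ℤ) → (x ℤ.* y) ℤ.* ℤ.1ℤ ≡ x ℤ.* (y ℤ.* ℤ.1ℤ)
      normalise = ℤ.solve-∀

  ofℕ-mono-≤ : ∀ {a b} → a ℕ.≤ b → ofℕ a ≤ ofℕ b
  ofℕ-mono-≤ {a} {b} a≤b = toℚᵘ-cancel-≤
    (ℚᵘ.≤-respʳ-≃ (ℚᵘ.≃-sym (toℚᵘ-ratℕ b 0)) (ℚᵘ.≤-respˡ-≃ (ℚᵘ.≃-sym (toℚᵘ-ratℕ a 0))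
    (ℚᵘ.*≤* (subst₂ ℤ._≤_ (sym (ℤ.*-identityʳ (ℤ.+ a))) (sym (ℤ.*-identityʳ (ℤ.+ b))) (ℤ.+≤+ a≤b)))))

  ofℕ-cancel-≤ : ∀ {a b} → ofℕ a ≤ ofℕ b → a ℕ.≤ b
  ofℕ-cancel-≤ {a} {b} a≤b with ℚᵘ.≤-respʳ-≃ (toℚᵘ-ratℕ b 0) (ℚᵘ.≤-respˡ-≃ (toℚᵘ-ratℕ a 0) (toℚᵘ-mono-≤ a≤b))
  ... | ℚᵘ.*≤* a*1≤b*1 = ℤ.drop‿+≤+ (subst₂ ℤ._≤_ (ℤ.*-identityʳ (ℤ.+ a)) (ℤ.*-identityʳ (ℤ.+ b)) a*1≤b*1)

  private
    t : ℚ → ℕ → ℚ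
    t = expTerm
    E : ℚ → ℕ → ℚ
    E = expPartial

  *-pres-0≤ : ∀ {p q} → 0ℚ ≤ p → 0ℚ ≤ q → 0ℚ ≤ p * q
  *-pres-0≤ {p} {q} 0≤p 0≤q = nonNegative⁻¹ _ {{nonNeg*nonNeg⇒nonNeg p {{ℚ.nonNegative 0≤p}} q {{ℚ.nonNegative 0≤q}}}}

  +-pres-0≤ : ∀ {p q} → 0ℚ ≤ p → 0ℚ ≤ q → 0ℚ ≤ p + q
  +-pres-0≤ = +-mono-≤

  *-monoˡ-≤-0≤ : ∀ {r p q} → 0ℚ ≤ r → p ≤ q → r * p ≤ r * q
  *-monoˡ-≤-0≤ {r} 0≤r = *-monoˡ-≤-nonNeg r {{ℚ.nonNegative 0≤r}}

  *-monoʳ-≤-0≤ : ∀ {r p q} → 0ℚ ≤ r → p ≤ q → p * r ≤ q * r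
  *-monoʳ-≤-0≤ {r} 0≤r = *-monoʳ-≤-nonNeg r {{ℚ.nonNegative 0≤r}}

  *-mono-≤-0≤ : ∀ {p q r s} → 0ℚ ≤ p → 0ℚ ≤ r → p ≤ q → r ≤ s → p * r ≤ q * s
  *-mono-≤-0≤ 0≤p 0≤r p≤q r≤s = ≤-trans (*-monoʳ-≤-0≤ 0≤r p≤q) (*-monoˡ-≤-0≤ (≤-trans 0≤p p≤q) r≤s)

  ratℕ-0≤ : ∀ k d → 0ℚ ≤ ratℕ k (suc d)
  ratℕ-0≤ k d = nonNegative⁻¹ _ {{normalize-nonNeg k (suc d)}}

  ofℕ-0≤ : ∀ a → 0ℚ ≤ ofℕ a
  ofℕ-0≤ a = ratℕ-0≤ a 0

  p≤q⇒p≤q+r : ∀ {p q r} → 0ℚ ≤ r → p ≤ q → p ≤ q + r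
  p≤q⇒p≤q+r {p} 0≤r p≤q = ≤-trans (≤-reflexive (sym (+-identityʳ p))) (+-mono-≤ p≤q 0≤r)

  +-cancelʳ-≤ : ∀ {p q} r → p + r ≤ q + r → p ≤ q
  +-cancelʳ-≤ {p} {q} r p+r≤q+r = begin
    p             ≡⟨ p+r-r≡p p ⟨
    p + r + ℚ.- r ≤⟨ +-monoˡ-≤ (ℚ.- r) p+r≤q+r ⟩
    q + r + ℚ.- r ≡⟨ p+r-r≡p q ⟩
    q             ∎
    where
    p+r-r≡p : ∀ p → p + r + ℚ.- r ≡ p
    p+r-r≡p p = solve 2 (λ p r → p :+ r :+ :- r := p) refl p r

  *-cancelʳ-≤-ofℕ : ∀ {p q} d → p * ofℕ (suc d) ≤ q * ofℕ (suc d) → p ≤ q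
  *-cancelʳ-≤-ofℕ d = *-cancelʳ-≤-pos (ofℕ (suc d)) {{normalize-pos (suc d) 1}}

  *-cancelʳ-≡-ofℕ : ∀ {p q} d → p * ofℕ (suc d) ≡ q * ofℕ (suc d) → p ≡ q
  *-cancelʳ-≡-ofℕ d eq = ≤-antisym (*-cancelʳ-≤-ofℕ d (≤-reflexive eq)) (*-cancelʳ-≤-ofℕ d (≤-reflexive (sym eq)))

  ratℕ-*-ofℕ-*-ofℕ : ∀ p k d → p * ratℕ k (suc d) * ofℕ (suc d) ≡ p * ofℕ k
  ratℕ-*-ofℕ-*-ofℕ p k d = trans (*-assoc p _ _) (cong (p *_) (ratℕ-*-ofℕ k d))

  expTerm-0≤ : ∀ {y} → 0ℚ ≤ y → ∀ i → 0ℚ ≤ t y i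
  expTerm-0≤ 0≤y zero    = ≤ᵇ⇒≤ tt
  expTerm-0≤ 0≤y (suc i) = *-pres-0≤ (*-pres-0≤ (expTerm-0≤ 0≤y i) 0≤y) (ratℕ-0≤ 1 i)

  expTerm-mono-≤ : ∀ {a b} → 0ℚ ≤ a → a ≤ b → ∀ i → t a i ≤ t b i
  expTerm-mono-≤ 0≤a a≤b zero    = ≤-refl
  expTerm-mono-≤ 0≤a a≤b (suc i) =
    *-monoʳ-≤-0≤ (ratℕ-0≤ 1 i) (*-mono-≤-0≤ (expTerm-0≤ 0≤a i) 0≤a (expTerm-mono-≤ 0≤a a≤b i) a≤b)

  expPartial-mono-≤ : ∀ {a b} → 0ℚ ≤ a → a ≤ b → ∀ K → E a K ≤ E b K
  expPartial-mono-≤ 0≤a a≤b zero    = ≤-refl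
  expPartial-mono-≤ 0≤a a≤b (suc K) = +-mono-≤ (expPartial-mono-≤ 0≤a a≤b K) (expTerm-mono-≤ 0≤a a≤b K)

  expPartial-≤-suc : ∀ {y} → 0ℚ ≤ y → ∀ K → E y K ≤ E y (suc K)
  expPartial-≤-suc 0≤y K = p≤q⇒p≤q+r (expTerm-0≤ 0≤y K) ≤-refl

  expPartial-≤-+ : ∀ {y} → 0ℚ ≤ y → ∀ K j → E y K ≤ E y (j ℕ.+ K)
  expPartial-≤-+ 0≤y K zero    = ≤-refl
  expPartial-≤-+ 0≤y K (suc j) = ≤-trans (expPartial-≤-+ 0≤y K j) (expPartial-≤-suc 0≤y (j ℕ.+ K))

  expPartial-0≡1 : ∀ K → E 0ℚ (suc K) ≡ 1ℚ
  expPartial-0≡1 zero    = refl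
  expPartial-0≡1 (suc K) = trans (cong₂ _+_ (expPartial-0≡1 K) expTerm-0-suc) (+-identityʳ 1ℚ)
    where
    expTerm-0-suc : t 0ℚ (suc K) ≡ 0ℚ
    expTerm-0-suc = trans (cong (_* ratℕ 1 (suc K)) (*-zeroʳ (t 0ℚ K))) (*-zeroˡ (ratℕ 1 (suc K)))

  expPartial-0≤1 : ∀ K → E 0ℚ K ≤ 1ℚ
  expPartial-0≤1 zero    = ≤ᵇ⇒≤ tt
  expPartial-0≤1 (suc K) = ≤-reflexive (expPartial-0≡1 K)

  expTerm-suc : ∀ y i → t y (suc i) * ofℕ (suc i) ≡ t y i * y
  expTerm-suc y i = trans (ratℕ-*-ofℕ-*-ofℕ (t y i * y) 1 i) (*-identityʳ _)

  private
    p*[1/n]*n≡p : ∀ p i → p * ratℕ 1 (suc i) * ofℕ (suc i) ≡ p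
    p*[1/n]*n≡p p i = trans (ratℕ-*-ofℕ-*-ofℕ p 1 i) (*-identityʳ p)

  -- The binomial bounds u^(i+1) + (i+1) x u^i ≤ (u + x)^(i+1) ≤ u^(i+1) + (i+1) x (u + x)^i
  -- for u, x ≥ 0, divided by (i + 1)!.
  expTerm-+-≥ : ∀ {u x} → 0ℚ ≤ u → 0ℚ ≤ x → ∀ i → t u (suc i) + x * t u i ≤ t (u + x) (suc i)
  expTerm-+-≥ {u} {x} 0≤u 0≤x zero =
    ≤-reflexive (solve 2 (λ u x → con 1ℚ :* u :* con 1ℚ :+ x :* con 1ℚ := con 1ℚ :* (u :+ x) :* con 1ℚ) refl u x)
  expTerm-+-≥ {u} {x} 0≤u 0≤x (suc i) = *-cancelʳ-≤-ofℕ (suc i) (begin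
    (A * u * c + x * A) * m                   ≡⟨ e₁ A u c m x ⟩
    A * u * (c * m) + x * A * m               ≡⟨ cong₂ (λ p q → A * u * p + x * A * q) (ratℕ-*-ofℕ 1 (suc i)) (ofℕ-+ 1 (suc i)) ⟩
    A * u * 1ℚ + x * A * (1ℚ + n)             ≡⟨ e₂ A u x n ⟩
    A * u + x * A + x * (A * n)               ≡⟨ cong (λ p → A * u + x * A + x * p) (expTerm-suc u i) ⟩
    A * u + x * A + x * (a₀ * u)              ≤⟨ p≤q⇒p≤q+r (*-pres-0≤ 0≤x (*-pres-0≤ 0≤x (expTerm-0≤ 0≤u i))) ≤-refl ⟩
    A * u + x * A + x * (a₀ * u) + x * (x * a₀) ≡⟨ e₃ A u x a₀ ⟩
    (A + x * a₀) * (u + x)                    ≤⟨ *-monoʳ-≤-0≤ (+-pres-0≤ 0≤u 0≤x) (expTerm-+-≥ 0≤u 0≤x i) ⟩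
    B * (u + x)                               ≡⟨ p*[1/n]*n≡p (B * (u + x)) (suc i) ⟨
    B * (u + x) * c * m                       ∎)
    where
    A = t u (suc i)
    a₀ = t u i
    B = t (u + x) (suc i)
    n = ofℕ (suc i)
    c = ratℕ 1 (suc (suc i))
    m = ofℕ (suc (suc i))
    e₁ : ∀ A u c m x → (A * u * c + x * A) * m ≡ A * u * (c * m) + x * A * m
    e₁ = solve 5 (λ A u c m x → (A :* u :* c :+ x :* A) :* m := A :* u :* (c :* m) :+ x :* A :* m) refl
    e₂ : ∀ A u x n → A * u * 1ℚ + x * A * (1ℚ + n) ≡ A * u + x * A + x * (A * n)
    e₂ = solve 4 (λ A u x n → A :* u :* con 1ℚ :+ x :* A :* (con 1ℚ :+ n) := A :* u :+ x :* A :+ x :* (A :* n)) refl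
    e₃ : ∀ A u x a₀ → A * u + x * A + x * (a₀ * u) + x * (x * a₀) ≡ (A + x * a₀) * (u + x)
    e₃ = solve 4 (λ A u x a₀ → A :* u :+ x :* A :+ x :* (a₀ :* u) :+ x :* (x :* a₀) := (A :+ x :* a₀) :* (u :+ x)) refl

  expTerm-+-≤ : ∀ {y x} → 0ℚ ≤ y → 0ℚ ≤ x → ∀ i → t (y + x) (suc i) ≤ t y (suc i) + x * t (y + x) i
  expTerm-+-≤ {y} {x} 0≤y 0≤x zero =
    ≤-reflexive (solve 2 (λ y x → con 1ℚ :* (y :+ x) :* con 1ℚ := con 1ℚ :* y :* con 1ℚ :+ x :* con 1ℚ) refl y x)
  expTerm-+-≤ {y} {x} 0≤y 0≤x (suc i) = *-cancelʳ-≤-ofℕ (suc i) (begin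
    Z * (y + x) * c * m                    ≡⟨ p*[1/n]*n≡p (Z * (y + x)) (suc i) ⟩
    Z * (y + x)                            ≡⟨ f₁ Z y x ⟩
    Z * y + x * Z                          ≤⟨ +-monoˡ-≤ (x * Z) (*-monoʳ-≤-0≤ 0≤y (expTerm-+-≤ 0≤y 0≤x i)) ⟩
    (Y + x * z₀) * y + x * Z               ≡⟨ f₂ Y x z₀ y Z ⟩
    Y * y + x * (z₀ * y) + x * Z           ≤⟨ +-monoˡ-≤ (x * Z) (+-monoʳ-≤ (Y * y) (*-monoˡ-≤-0≤ 0≤x z₀*y≤z₀*[y+x])) ⟩
    Y * y + x * (z₀ * (y + x)) + x * Z     ≡⟨ cong (λ p → Y * y + x * p + x * Z) (expTerm-suc (y + x) i) ⟨
    Y * y + x * (Z * n) + x * Z            ≡⟨ f₃ Y y x Z n ⟩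
    Y * y * 1ℚ + x * Z * (1ℚ + n)          ≡⟨ cong₂ (λ p q → Y * y * p + x * Z * q) (ratℕ-*-ofℕ 1 (suc i)) (ofℕ-+ 1 (suc i)) ⟨
    Y * y * (c * m) + x * Z * m            ≡⟨ f₄ Y y c m x Z ⟩
    (Y * y * c + x * Z) * m                ∎)
    where
    Z = t (y + x) (suc i)
    z₀ = t (y + x) i
    Y = t y (suc i)
    n = ofℕ (suc i)
    c = ratℕ 1 (suc (suc i))
    m = ofℕ (suc (suc i))
    z₀*y≤z₀*[y+x] : z₀ * y ≤ z₀ * (y + x)
    z₀*y≤z₀*[y+x] = *-monoˡ-≤-0≤ (expTerm-0≤ (+-pres-0≤ 0≤y 0≤x) i) (p≤q⇒p≤q+r 0≤x ≤-refl)
    f₁ : ∀ Z y x → Z * (y + x) ≡ Z * y + x * Z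
    f₁ = solve 3 (λ Z y x → Z :* (y :+ x) := Z :* y :+ x :* Z) refl
    f₂ : ∀ Y x z₀ y Z → (Y + x * z₀) * y + x * Z ≡ Y * y + x * (z₀ * y) + x * Z
    f₂ = solve 5 (λ Y x z₀ y Z → (Y :+ x :* z₀) :* y :+ x :* Z := Y :* y :+ x :* (z₀ :* y) :+ x :* Z) refl
    f₃ : ∀ Y y x Z n → Y * y + x * (Z * n) + x * Z ≡ Y * y * 1ℚ + x * Z * (1ℚ + n)
    f₃ = solve 5 (λ Y y x Z n → Y :* y :+ x :* (Z :* n) :+ x :* Z := Y :* y :* con 1ℚ :+ x :* Z :* (con 1ℚ :+ n)) refl
    f₄ : ∀ Y y c m x Z → Y * y * (c * m) + x * Z * m ≡ (Y * y * c + x * Z) * m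
    f₄ = solve 6 (λ Y y c m x Z → Y :* y :* (c :* m) :+ x :* Z :* m := (Y :* y :* c :+ x :* Z) :* m) refl

  expPartial-+-≥ : ∀ {u x} → 0ℚ ≤ u → 0ℚ ≤ x → ∀ K → E u (suc K) + x * E u K ≤ E (u + x) (suc K)
  expPartial-+-≥ {u} {x} 0≤u 0≤x zero =
    ≤-reflexive (solve 1 (λ x → con 0ℚ :+ con 1ℚ :+ x :* con 0ℚ := con 0ℚ :+ con 1ℚ) refl x)
  expPartial-+-≥ {u} {x} 0≤u 0≤x (suc K) = begin
    E u (suc K) + t u (suc K) + x * (E u K + t u K)        ≡⟨ g (E u (suc K)) (t u (suc K)) x (E u K) (t u K) ⟩
    (E u (suc K) + x * E u K) + (t u (suc K) + x * t u K)  ≤⟨ +-mono-≤ (expPartial-+-≥ 0≤u 0≤x K) (expTerm-+-≥ 0≤u 0≤x K) ⟩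
    E (u + x) (suc K) + t (u + x) (suc K)                  ∎
    where
    g : ∀ a b x c d → a + b + x * (c + d) ≡ (a + x * c) + (b + x * d)
    g = solve 5 (λ a b x c d → a :+ b :+ x :* (c :+ d) := (a :+ x :* c) :+ (b :+ x :* d)) refl

  expPartial-+-≤ : ∀ {y x} → 0ℚ ≤ y → 0ℚ ≤ x → ∀ K → E (y + x) (suc K) ≤ E y (suc K) + x * E (y + x) K
  expPartial-+-≤ {y} {x} 0≤y 0≤x zero =
    ≤-reflexive (solve 1 (λ x → con 0ℚ :+ con 1ℚ := con 0ℚ :+ con 1ℚ :+ x :* con 0ℚ) refl x)
  expPartial-+-≤ {y} {x} 0≤y 0≤x (suc K) = begin
    E (y + x) (suc K) + t (y + x) (suc K)                              ≤⟨ +-mono-≤ (expPartial-+-≤ 0≤y 0≤x K) (expTerm-+-≤ 0≤y 0≤x K) ⟩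
    (E y (suc K) + x * E (y + x) K) + (t y (suc K) + x * t (y + x) K)  ≡⟨ g (E y (suc K)) (t y (suc K)) x (E (y + x) K) (t (y + x) K) ⟩
    E y (suc K) + t y (suc K) + x * (E (y + x) K + t (y + x) K)        ∎
    where
    g : ∀ a b x c d → (a + x * c) + (b + x * d) ≡ a + b + x * (c + d)
    g = solve 5 (λ a b x c d → (a :+ x :* c) :+ (b :+ x :* d) := a :+ b :+ x :* (c :+ d)) refl

  ofℕ-suc-* : ∀ L x → ofℕ (suc L) * x ≡ ofℕ L * x + x
  ofℕ-suc-* L x = trans (cong (_* x) (ofℕ-+ 1 L)) (solve 2 (λ l x → (con 1ℚ :+ l) :* x := l :* x :+ x) refl (ofℕ L) x)

  module _ {a k d : ℕ} (a+k≡1+d : a ℕ.+ k ≡ suc d) where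

    private
      x = ratℕ k (suc d)
      D = ofℕ (suc d)
      0≤x : 0ℚ ≤ x
      0≤x = ratℕ-0≤ k d

    expPartial-+-*-≤ : ∀ {y} → 0ℚ ≤ y → ∀ K → E (y + x) K * ofℕ a ≤ E y K * D
    expPartial-+-*-≤ {y} 0≤y K = +-cancelʳ-≤ (Z * ofℕ k) (begin
      Z * ofℕ a + Z * ofℕ k    ≡⟨ *-distribˡ-+ Z (ofℕ a) (ofℕ k) ⟨
      Z * (ofℕ a + ofℕ k)      ≡⟨ cong (Z *_) (trans (sym (ofℕ-+ a k)) (cong ofℕ a+k≡1+d)) ⟩
      Z * D                    ≤⟨ *-monoʳ-≤-0≤ (ofℕ-0≤ (suc d)) (Z≤ K) ⟩
      (E y K + x * Z) * D      ≡⟨ h (E y K) x Z D ⟩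
      E y K * D + Z * (x * D)  ≡⟨ cong (λ p → E y K * D + Z * p) (ratℕ-*-ofℕ k d) ⟩
      E y K * D + Z * ofℕ k    ∎)
      where
      Z = E (y + x) K
      h : ∀ e x z D → (e + x * z) * D ≡ e * D + z * (x * D)
      h = solve 4 (λ e x z D → (e :+ x :* z) :* D := e :* D :+ z :* (x :* D)) refl
      Z≤ : ∀ K → E (y + x) K ≤ E y K + x * E (y + x) K
      Z≤ zero    = ≤-reflexive (sym (trans (+-identityˡ (x * 0ℚ)) (*-zeroʳ x)))
      Z≤ (suc K) = ≤-trans (expPartial-+-≤ 0≤y 0≤x K)
                           (+-monoʳ-≤ (E y (suc K)) (*-monoˡ-≤-0≤ 0≤x (expPartial-≤-suc (+-pres-0≤ 0≤y 0≤x) K)))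

    expPartial[L*k/d]*a^L≤d^L : ∀ L K → E (ofℕ L * x) K * ofℕ (a ^ L) ≤ ofℕ (suc d ^ L)
    expPartial[L*k/d]*a^L≤d^L zero K = begin
      E (ofℕ 0 * x) K * ofℕ 1  ≡⟨ trans (*-identityʳ _) (cong (λ p → E p K) (*-zeroˡ x)) ⟩
      E 0ℚ K                    ≤⟨ expPartial-0≤1 K ⟩
      1ℚ                        ∎
    expPartial[L*k/d]*a^L≤d^L (suc L) K = begin
      E (ofℕ (suc L) * x) K * ofℕ (a ^ suc L)  ≡⟨ cong₂ (λ p q → E p K * q) (ofℕ-suc-* L x) (ofℕ-* a (a ^ L)) ⟩
      E (y + x) K * (ofℕ a * ofℕ (a ^ L))      ≡⟨ *-assoc (E (y + x) K) (ofℕ a) (ofℕ (a ^ L)) ⟨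
      E (y + x) K * ofℕ a * ofℕ (a ^ L)        ≤⟨ *-monoʳ-≤-0≤ (ofℕ-0≤ (a ^ L)) (expPartial-+-*-≤ 0≤y K) ⟩
      E y K * D * ofℕ (a ^ L)                  ≡⟨ h (E y K) D (ofℕ (a ^ L)) ⟩
      E y K * ofℕ (a ^ L) * D                  ≤⟨ *-monoʳ-≤-0≤ (ofℕ-0≤ (suc d)) (expPartial[L*k/d]*a^L≤d^L L K) ⟩
      ofℕ (suc d ^ L) * D                      ≡⟨ trans (*-comm _ D) (sym (ofℕ-* (suc d) (suc d ^ L))) ⟩
      ofℕ (suc d ^ suc L)                      ∎
      where
      y = ofℕ L * x
      0≤y : 0ℚ ≤ y
      0≤y = *-pres-0≤ (ofℕ-0≤ L) 0≤x
      h : ∀ e D p → e * D * p ≡ e * p * D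
      h = solve 3 (λ e D p → e :* D :* p := e :* p :* D) refl

  module _ {a′ k : ℕ} where

    private
      a = suc a′
      x = ratℕ k a
      0≤x : 0ℚ ≤ x
      0≤x = ratℕ-0≤ k a′

    [a+k]^n≤expPartial[n*k/a]*a^n : ∀ n → ofℕ ((a ℕ.+ k) ^ n) ≤ E (ofℕ n * x) (suc n) * ofℕ (a ^ n)
    [a+k]^n≤expPartial[n*k/a]*a^n zero    = ≤ᵇ⇒≤ tt
    [a+k]^n≤expPartial[n*k/a]*a^n (suc n) = begin
      ofℕ ((a ℕ.+ k) ^ suc n)                          ≡⟨ ofℕ-* (a ℕ.+ k) ((a ℕ.+ k) ^ n) ⟩
      ofℕ (a ℕ.+ k) * ofℕ ((a ℕ.+ k) ^ n)               ≤⟨ *-monoˡ-≤-0≤ (ofℕ-0≤ (a ℕ.+ k)) ([a+k]^n≤expPartial[n*k/a]*a^n n) ⟩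
      ofℕ (a ℕ.+ k) * (Eₙ * ofℕ (a ^ n))                ≡⟨ cong (λ p → p * (Eₙ * ofℕ (a ^ n))) a+k≡[1+x]*a ⟩
      (1ℚ + x) * ofℕ a * (Eₙ * ofℕ (a ^ n))             ≡⟨ h x (ofℕ a) Eₙ (ofℕ (a ^ n)) ⟩
      (Eₙ + x * Eₙ) * (ofℕ a * ofℕ (a ^ n))             ≤⟨ *-monoʳ-≤-0≤ (*-pres-0≤ (ofℕ-0≤ a) (ofℕ-0≤ (a ^ n))) step ⟩
      E (y + x) (suc (suc n)) * (ofℕ a * ofℕ (a ^ n))   ≡⟨ cong₂ (λ p q → E p (suc (suc n)) * q) (ofℕ-suc-* n x) (ofℕ-* a (a ^ n)) ⟨
      E (ofℕ (suc n) * x) (suc (suc n)) * ofℕ (a ^ suc n) ∎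
      where
      y = ofℕ n * x
      0≤y : 0ℚ ≤ y
      0≤y = *-pres-0≤ (ofℕ-0≤ n) 0≤x
      Eₙ = E y (suc n)
      a+k≡[1+x]*a : ofℕ (a ℕ.+ k) ≡ (1ℚ + x) * ofℕ a
      a+k≡[1+x]*a = trans (ofℕ-+ a k) (trans (cong (ofℕ a +_) (sym (ratℕ-*-ofℕ k a′)))
                      (solve 2 (λ A x → A :+ x :* A := (con 1ℚ :+ x) :* A) refl (ofℕ a) x))
      h : ∀ x A e p → (1ℚ + x) * A * (e * p) ≡ (e + x * e) * (A * p)
      h = solve 4 (λ x A e p → (con 1ℚ :+ x) :* A :* (e :* p) := (e :+ x :* e) :* (A :* p)) refl
      step : Eₙ + x * Eₙ ≤ E (y + x) (suc (suc n))
      step = ≤-trans (+-monoˡ-≤ (x * Eₙ) (expPartial-≤-suc 0≤y (suc n))) (expPartial-+-≥ 0≤y 0≤x (suc n))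

  -- Beyond k the terms at least halve, so the tail of the series is at most twice its first term.
  expPartial-≤-tail : ∀ {y} k → 0ℚ ≤ y → y + y ≤ ofℕ (suc k) → ∀ K → E y K ≤ E y k + (t y k + t y k)
  expPartial-≤-tail {y} k 0≤y y+y≤1+k K with ℕ.≤-total K k
  ... | inj₁ K≤k = ≤-trans (subst (λ K′ → E y K ≤ E y K′) (ℕ.m∸n+n≡m K≤k) (expPartial-≤-+ 0≤y K (k ℕ.∸ K)))
                           (p≤q⇒p≤q+r (+-pres-0≤ (expTerm-0≤ 0≤y k) (expTerm-0≤ 0≤y k)) ≤-refl)
  ... | inj₂ k≤K = subst (λ K′ → E y K′ ≤ G 0) (ℕ.m∸n+n≡m k≤K) (≤-trans (E≤G (K ℕ.∸ k)) (G-≤-G0 (K ℕ.∸ k)))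
    where
    G : ℕ → ℚ
    G j = E y (j ℕ.+ k) + (t y (j ℕ.+ k) + t y (j ℕ.+ k))
    E≤G : ∀ j → E y (j ℕ.+ k) ≤ G j
    E≤G j = p≤q⇒p≤q+r (+-pres-0≤ (expTerm-0≤ 0≤y (j ℕ.+ k)) (expTerm-0≤ 0≤y (j ℕ.+ k))) ≤-refl
    halves : ∀ i → k ℕ.≤ i → t y (suc i) + t y (suc i) ≤ t y i
    halves i k≤i = begin
      t y i * y * c + t y i * y * c  ≡⟨ h (t y i) y c ⟩
      t y i * ((y + y) * c)          ≤⟨ *-monoˡ-≤-0≤ (expTerm-0≤ 0≤y i) [y+y]*c≤1 ⟩
      t y i * 1ℚ                     ≡⟨ *-identityʳ (t y i) ⟩
      t y i                          ∎
      where
      c = ratℕ 1 (suc i)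
      h : ∀ a y c → a * y * c + a * y * c ≡ a * ((y + y) * c)
      h = solve 3 (λ a y c → a :* y :* c :+ a :* y :* c := a :* ((y :+ y) :* c)) refl
      [y+y]*c≤1 : (y + y) * c ≤ 1ℚ
      [y+y]*c≤1 = *-cancelʳ-≤-ofℕ i (begin
        (y + y) * c * ofℕ (suc i)  ≡⟨ p*[1/n]*n≡p (y + y) i ⟩
        y + y                      ≤⟨ ≤-trans y+y≤1+k (ofℕ-mono-≤ (ℕ.s≤s k≤i)) ⟩
        ofℕ (suc i)                ≡⟨ *-identityˡ (ofℕ (suc i)) ⟨
        1ℚ * ofℕ (suc i)           ∎)
    G-≤-G0 : ∀ j → G j ≤ G 0
    G-≤-G0 zero    = ≤-refl
    G-≤-G0 (suc j) = ≤-trans G[1+j]≤G[j] (G-≤-G0 j)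
      where
      i = j ℕ.+ k
      G[1+j]≤G[j] : G (suc j) ≤ G j
      G[1+j]≤G[j] = begin
        E y i + t y i + (t y (suc i) + t y (suc i))  ≤⟨ +-monoʳ-≤ (E y i + t y i) (halves i (ℕ.m≤n+m k j)) ⟩
        E y i + t y i + t y i                        ≡⟨ +-assoc (E y i) (t y i) (t y i) ⟩
        E y i + (t y i + t y i)                      ∎

  expPartial[80/29]≤16 : ∀ K → E (ratℕ 80 29) K ≤ ofℕ 16
  expPartial[80/29]≤16 K = ≤-trans (expPartial-≤-tail 16 (≤ᵇ⇒≤ tt) (≤ᵇ⇒≤ tt) K) (≤ᵇ⇒≤ tt)

  -- With T = T′ + 1 and a = 3T − 2: (1 + 8/a)^T ≤ exp(8T/a) ≤ exp(80/29) < 16 once T ≥ 20,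
  -- and the finitely many smaller T are checked by evaluation.
  [a+8]^T≤16*a^T : ∀ T′ → (suc (3 ℕ.* T′) ℕ.+ 8) ^ suc T′ ℕ.≤ 16 ℕ.* suc (3 ℕ.* T′) ^ suc T′
  [a+8]^T≤16*a^T T′ with T′ ℕ.<? 19
  ... | yes T′<19 = All.lookup (toWitness {a? = All.all? bound? (upTo 19)} tt) (∈-upTo⁺ T′<19)
    where
    bound? : ∀ T′ → Dec ((suc (3 ℕ.* T′) ℕ.+ 8) ^ suc T′ ℕ.≤ 16 ℕ.* suc (3 ℕ.* T′) ^ suc T′)
    bound? T′ = (suc (3 ℕ.* T′) ℕ.+ 8) ^ suc T′ ℕ.≤? 16 ℕ.* suc (3 ℕ.* T′) ^ suc T′
  ... | no  T′≮19 = ofℕ-cancel-≤ (begin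
    ofℕ ((a ℕ.+ 8) ^ T)                       ≤⟨ [a+k]^n≤expPartial[n*k/a]*a^n T ⟩
    E (ofℕ T * ratℕ 8 a) (suc T) * ofℕ (a ^ T) ≤⟨ *-monoʳ-≤-0≤ (ofℕ-0≤ (a ^ T)) (expPartial-mono-≤ 0≤T*8/a T*8/a≤80/29 (suc T)) ⟩
    E (ratℕ 80 29) (suc T) * ofℕ (a ^ T)      ≤⟨ *-monoʳ-≤-0≤ (ofℕ-0≤ (a ^ T)) (expPartial[80/29]≤16 (suc T)) ⟩
    ofℕ 16 * ofℕ (a ^ T)                      ≡⟨ ofℕ-* 16 (a ^ T) ⟨
    ofℕ (16 ℕ.* a ^ T)                        ∎)
    where
    T = suc T′
    a = suc (3 ℕ.* T′)
    0≤T*8/a : 0ℚ ≤ ofℕ T * ratℕ 8 a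
    0≤T*8/a = *-pres-0≤ (ofℕ-0≤ T) (ratℕ-0≤ 8 (3 ℕ.* T′))
    T*8*29≤80*a : T ℕ.* 8 ℕ.* 29 ℕ.≤ 80 ℕ.* a
    T*8*29≤80*a = subst (λ T′ → suc T′ ℕ.* 8 ℕ.* 29 ℕ.≤ 80 ℕ.* suc (3 ℕ.* T′)) {T′ ℕ.∸ 19 ℕ.+ 19} {T′}
                        (ℕ.m∸n+n≡m (ℕ.≮⇒≥ T′≮19)) (linear (T′ ℕ.∸ 19))
      where
      linear : ∀ j → suc (j ℕ.+ 19) ℕ.* 8 ℕ.* 29 ℕ.≤ 80 ℕ.* suc (3 ℕ.* (j ℕ.+ 19))
      linear j = subst₂ ℕ._≤_ (sym (lhs j)) (sym (rhs j)) (ℕ.+-monoʳ-≤ 4640 (ℕ.*-monoˡ-≤ j (ℕ.≤ᵇ⇒≤ 232 240 tt)))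
        where
        lhs : ∀ j → suc (j ℕ.+ 19) ℕ.* 8 ℕ.* 29 ≡ 4640 ℕ.+ 232 ℕ.* j
        lhs = ℕ.solve-∀
        rhs : ∀ j → 80 ℕ.* suc (3 ℕ.* (j ℕ.+ 19)) ≡ 4640 ℕ.+ 240 ℕ.* j
        rhs = ℕ.solve-∀
    T*8/a≤80/29 : ofℕ T * ratℕ 8 a ≤ ratℕ 80 29
    T*8/a≤80/29 = *-cancelʳ-≤-ofℕ (3 ℕ.* T′) (*-cancelʳ-≤-ofℕ 28 (begin
      ofℕ T * ratℕ 8 a * ofℕ a * ofℕ 29  ≡⟨ cong (_* ofℕ 29) (trans (ratℕ-*-ofℕ-*-ofℕ (ofℕ T) 8 (3 ℕ.* T′)) (sym (ofℕ-* T 8))) ⟩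
      ofℕ (T ℕ.* 8) * ofℕ 29             ≡⟨ ofℕ-* (T ℕ.* 8) 29 ⟨
      ofℕ (T ℕ.* 8 ℕ.* 29)               ≤⟨ ofℕ-mono-≤ T*8*29≤80*a ⟩
      ofℕ (80 ℕ.* a)                     ≡⟨ ofℕ-* 80 a ⟩
      ofℕ 80 * ofℕ a                     ≡⟨ cong (_* ofℕ a) (ratℕ-*-ofℕ 80 28) ⟨
      ratℕ 80 29 * ofℕ 29 * ofℕ a        ≡⟨ swap (ratℕ 80 29) (ofℕ 29) (ofℕ a) ⟩
      ratℕ 80 29 * ofℕ a * ofℕ 29        ∎))
      where
      swap : ∀ p q r → p * q * r ≡ p * r * q
      swap = solve 3 (λ p q r → p :* q :* r := p :* r :* q) refl

  X*expPartial[kL/d]≤Y : ∀ {a k d} .{{_ : ℕ.NonZero a}} → a ℕ.+ k ≡ suc d → ∀ X Y L → X ℕ.* suc d ^ L ℕ.≤ Y ℕ.* a ^ L →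
                         ∀ K → ofℕ X * E (ratℕ (k ℕ.* L) (suc d)) K ≤ ofℕ Y
  X*expPartial[kL/d]≤Y {a} {k} {d} a+k≡1+d X Y L Xd^L≤Ya^L K = *-cancelʳ-≤-pos (ofℕ (a ^ L)) {{a^L>0}} (begin
    ofℕ X * E r K * ofℕ (a ^ L)          ≡⟨ *-assoc (ofℕ X) (E r K) (ofℕ (a ^ L)) ⟩
    ofℕ X * (E r K * ofℕ (a ^ L))        ≡⟨ cong (λ p → ofℕ X * (E p K * ofℕ (a ^ L))) r≡L*k/d ⟩
    ofℕ X * (E (ofℕ L * ratℕ k (suc d)) K * ofℕ (a ^ L)) ≤⟨ *-monoˡ-≤-0≤ (ofℕ-0≤ X) (expPartial[L*k/d]*a^L≤d^L a+k≡1+d L K) ⟩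
    ofℕ X * ofℕ (suc d ^ L)              ≡⟨ ofℕ-* X (suc d ^ L) ⟨
    ofℕ (X ℕ.* suc d ^ L)                ≤⟨ ofℕ-mono-≤ Xd^L≤Ya^L ⟩
    ofℕ (Y ℕ.* a ^ L)                    ≡⟨ ofℕ-* Y (a ^ L) ⟩
    ofℕ Y * ofℕ (a ^ L)                  ∎)
    where
    r = ratℕ (k ℕ.* L) (suc d)
    instance
      a^L≢0 : ℕ.NonZero (a ^ L)
      a^L≢0 = ℕ.m^n≢0 a L
    a^L>0 : ℚ.Positive (ofℕ (a ^ L))
    a^L>0 = normalize-pos (a ^ L) 1
    r≡L*k/d : r ≡ ofℕ L * ratℕ k (suc d)
    r≡L*k/d = *-cancelʳ-≡-ofℕ d (begin-equality
      r * ofℕ (suc d)                      ≡⟨ ratℕ-*-ofℕ (k ℕ.* L) d ⟩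
      ofℕ (k ℕ.* L)                        ≡⟨ cong ofℕ (ℕ.*-comm k L) ⟩
      ofℕ (L ℕ.* k)                        ≡⟨ ofℕ-* L k ⟩
      ofℕ L * ofℕ k                        ≡⟨ ratℕ-*-ofℕ-*-ofℕ (ofℕ L) k d ⟨
      ofℕ L * ratℕ k (suc d) * ofℕ (suc d) ∎)

open ExponentialSeries using (X*expPartial[kL/d]≤Y; [a+8]^T≤16*a^T)
open import Data.Nat using (_+_; _*_; _∸_; _≤_; _<_; _<?_; _≤?_; z≤n; s≤s; NonZero; ⌈_/2⌉; ⌊_/2⌋)
open import Data.Nat.Properties
open import Data.Nat.DivMod
open import Data.Nat.Divisibility
  using (_∣_; divides; n∣m⇒m%n≡0; m%n≡0⇒n∣m; ∣⇒≤; ∣-trans; m∣m*n; n∣m*n; *-monoʳ-∣; *-cancelˡ-∣; ∣m⇒∣m*n; %-presˡ-∣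
        ; ∣m∣n⇒∣m+n; ∣-refl; 1∣_)
open import Data.Nat.Induction using (<-rec)
open import Data.Nat.Logarithm using (⌈log₂_⌉; ⌈log₂⌉-mono-≤; ⌈log₂⌈n/2⌉⌉≡⌈log₂n⌉∸1; ⌈log₂2^n⌉≡n)
open import Data.Nat.ListAction using (sum)
open import Data.Nat.ListAction.Properties using (sum-++)
open import Data.Nat.Tactic.RingSolver using (solve-∀)
open import Algebra.Properties.CommutativeSemigroup +-commutativeSemigroup using () renaming (interchange to +-interchange)
open import Algebra.Properties.CommutativeSemigroup *-commutativeSemigroup using () renaming (x∙yz≈y∙xz to *-x∙yz≈y∙xz)
import Data.Rational as ℚ
open import Data.Bool using (true; false; if_then_else_)
open import Data.Product using (∃₂; _×_; _,_; proj₂)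
open import Data.Sum using (_⊎_; inj₁; inj₂; [_,_]′)
open import Data.List using (List; []; _∷_; length; filter; map; concatMap; _++_; upTo)
open import Data.List.Properties
  using (length-filter; filter-accept; filter-reject; filter-all; filter-none; filter-notAll; filter-++
        ; length-map; length-++; length-upTo; map-++; map-cong; map-∘; upTo-∷ʳ)
open import Data.List.Relation.Unary.All as All using (All; []; _∷_)
import Data.List.Relation.Unary.All.Properties as All
open import Data.List.Relation.Unary.Any as Any using (here; there)
open import Data.List.Relation.Unary.Unique.Propositional using (Unique; []; _∷_)
import Data.List.Relation.Unary.Unique.Propositional.Properties as Unique
open import Data.List.Membership.Propositional using (_∈_)
open import Data.List.Membership.Propositional.Properties using (∈-filter⁻; ∈-upTo⁻)
open import Data.List.Relation.Binary.Sublist.Propositional using (⊆-refl)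
open import Data.List.Relation.Binary.Sublist.Propositional.Properties using (filter⁺; length-mono-≤)
open import Function using (_∘_)
open import Relation.Binary using (tri<; tri≈; tri>)
open import Relation.Nullary using (¬_; ¬?; Dec; yes; no; does; contradiction)
open import Relation.Unary using (Decidable)

Odd : ℕ → Set
Odd n = n % 2 ≡ 1

parity : ∀ n → n % 2 ≡ 0 ⊎ Odd n
parity n with n % 2 | m%n<n n 2
... | 0           | _                 = inj₁ refl
... | 1           | _                 = inj₂ refl
... | suc (suc _) | s≤s (s≤s ())

Odd-* : ∀ {m n} → Odd m → Odd n → Odd (m * n)
Odd-* {m} {n} odd-m odd-n = trans (%-distribˡ-* m n 2) (cong₂ (λ p q → p * q % 2) odd-m odd-n)

Odd⇒2∤ : ∀ {n} → Odd n → ¬ 2 ∣ n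
Odd⇒2∤ {n} odd-n 2∣n with trans (sym odd-n) (n∣m⇒m%n≡0 n 2 2∣n)
... | ()

even⇒≡2*half : ∀ {n} → n % 2 ≡ 0 → n ≡ 2 * (n / 2)
even⇒≡2*half {n} n%2≡0 = trans (m≡m%n+[m/n]*n n 2) (trans (cong (_+ n / 2 * 2) n%2≡0) (*-comm (n / 2) 2))

2^r∣m*odd⇒2^r∣m : ∀ r m {o} → Odd o → 2 ^ r ∣ m * o → 2 ^ r ∣ m
2^r∣m*odd⇒2^r∣m zero    m _     _ = 1∣ m
2^r∣m*odd⇒2^r∣m (suc r) m {o} odd-o 2^1+r∣m*o with parity m
... | inj₂ odd-m = contradiction (∣-trans (m∣m*n (2 ^ r)) 2^1+r∣m*o) (Odd⇒2∤ (Odd-* {m} odd-m odd-o))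
... | inj₁ even-m = subst (2 ^ suc r ∣_) (sym m≡2*half)
  (*-monoʳ-∣ 2 (2^r∣m*odd⇒2^r∣m r (m / 2) odd-o (*-cancelˡ-∣ 2 (subst (2 ^ suc r ∣_) m*o≡2*[half*o] 2^1+r∣m*o))))
  where
  m≡2*half : m ≡ 2 * (m / 2)
  m≡2*half = even⇒≡2*half even-m
  m*o≡2*[half*o] : m * o ≡ 2 * (m / 2 * o)
  m*o≡2*[half*o] = trans (cong (_* o) m≡2*half) (*-assoc 2 (m / 2) o)

odd-part : ∀ w z → 0 < z → z < 2 ^ w → ∃₂ λ s o → Odd o × s < w × z ≡ 2 ^ s * o
odd-part zero    (suc z) _ (s≤s ())
odd-part (suc w) z 0<z z<2^1+w with parity z
... | inj₂ odd-z = 0 , z , odd-z , s≤s z≤n , sym (*-identityˡ z)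
... | inj₁ even-z with odd-part w (z / 2) 0<half half<2^w
  where
  0<half : 0 < z / 2
  0<half = m≥n⇒m/n>0 (∣⇒≤ {{ℕ.>-nonZero 0<z}} (m%n≡0⇒n∣m z 2 even-z))
  half<2^w : z / 2 < 2 ^ w
  half<2^w = m<n*o⇒m/o<n (subst (z <_) (*-comm 2 (2 ^ w)) z<2^1+w)
... | s , o , odd-o , s<w , half≡2^s*o =
  suc s , o , odd-o , s≤s s<w , trans (even⇒≡2*half even-z) (trans (cong (2 *_) half≡2^s*o) (sym (*-assoc 2 (2 ^ s) o)))

module _ {d : ℕ} .{{_ : NonZero d}} where

  [m+n]%d≡[m+o]%d⇒n%d≡o%d : ∀ {m n o} → m < d → (m + n) % d ≡ (m + o) % d → n % d ≡ o % d
  [m+n]%d≡[m+o]%d⇒n%d≡o%d {m} {n} {o} m<d eq = begin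
    n % d                          ≡⟨ shift n ⟨
    ((d ∸ m) + (m + n) % d) % d    ≡⟨ cong (λ k → ((d ∸ m) + k) % d) eq ⟩
    ((d ∸ m) + (m + o) % d) % d    ≡⟨ shift o ⟩
    o % d                          ∎
    where
    open ≡-Reasoning
    shift : ∀ v → ((d ∸ m) + (m + v) % d) % d ≡ v % d
    shift v = begin
      ((d ∸ m) + (m + v) % d) % d  ≡⟨ %-distribˡ-+ (d ∸ m) ((m + v) % d) d ⟩
      ((d ∸ m) % d + (m + v) % d % d) % d ≡⟨ cong (λ k → ((d ∸ m) % d + k) % d) (m%n%n≡m%n (m + v) d) ⟩
      ((d ∸ m) % d + (m + v) % d) % d ≡⟨ %-distribˡ-+ (d ∸ m) (m + v) d ⟨
      ((d ∸ m) + (m + v)) % d      ≡⟨ cong (_% d) (+-assoc (d ∸ m) m v) ⟨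
      ((d ∸ m) + m + v) % d        ≡⟨ cong (λ k → (k + v) % d) (m∸n+n≡m (<⇒≤ m<d)) ⟩
      (d + v) % d                  ≡⟨ cong (_% d) (+-comm d v) ⟩
      (v + d) % d                  ≡⟨ [m+n]%n≡m%n v d ⟩
      v % d                        ∎

  m%d≡n%d⇒d∣n∸m : ∀ {m n} → m ≤ n → m % d ≡ n % d → d ∣ n ∸ m
  m%d≡n%d⇒d∣n∸m {m} {n} m≤n eq = divides (n / d ∸ m / d) (begin
    n ∸ m                                     ≡⟨ cong₂ _∸_ (m≡m%n+[m/n]*n n d) (m≡m%n+[m/n]*n m d) ⟩
    (n % d + n / d * d) ∸ (m % d + m / d * d) ≡⟨ cong (λ r → (n % d + n / d * d) ∸ (r + m / d * d)) eq ⟩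
    (n % d + n / d * d) ∸ (n % d + m / d * d) ≡⟨ [m+n]∸[m+o]≡n∸o (n % d) _ _ ⟩
    n / d * d ∸ m / d * d                     ≡⟨ *-distribʳ-∸ d (n / d) (m / d) ⟨
    (n / d ∸ m / d) * d                       ∎)
    where open ≡-Reasoning

  m/d≡n/d⇒m<n+d : ∀ {m n} → m / d ≡ n / d → m < n + d
  m/d≡n/d⇒m<n+d {m} {n} eq = begin-strict
    m                  ≡⟨ m≡m%n+[m/n]*n m d ⟩
    m % d + m / d * d  <⟨ +-monoˡ-< (m / d * d) (m%n<n m d) ⟩
    d + m / d * d      ≡⟨ cong (λ r → d + r * d) eq ⟩
    d + n / d * d      ≤⟨ +-monoʳ-≤ d (m/n*n≤m n d) ⟩
    d + n              ≡⟨ +-comm d n ⟩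
    n + d              ∎
    where open ≤-Reasoning

  [q*d+r]%d≡r : ∀ q {r} → r < d → (q * d + r) % d ≡ r
  [q*d+r]%d≡r q {r} r<d = trans (cong (_% d) (+-comm (q * d) r)) (trans ([m+kn]%n≡m%n r q d) (m<n⇒m%n≡m r<d))

  [q*d+r]/d≡q : ∀ q {r} → r < d → (q * d + r) / d ≡ q
  [q*d+r]/d≡q q {r} r<d = trans (cong (_/ d) (+-comm (q * d) r))
    (trans (+-distrib-/-∣ʳ r (n∣m*n q)) (cong₂ _+_ (m<n⇒m/n≡0 r<d) (m*n/n≡m q d)))

  [m%d+n]%d≡[m+n]%d : ∀ m n → (m % d + n) % d ≡ (m + n) % d
  [m%d+n]%d≡[m+n]%d m n = begin
    (m % d + n) % d          ≡⟨ %-distribˡ-+ (m % d) n d ⟩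
    (m % d % d + n % d) % d  ≡⟨ cong (λ k → (k + n % d) % d) (m%n%n≡m%n m d) ⟩
    (m % d + n % d) % d      ≡⟨ %-distribˡ-+ m n d ⟨
    (m + n) % d              ∎
    where open ≡-Reasoning

  d∣n∸m⇒m%d≡n%d : ∀ {m n} → m ≤ n → d ∣ n ∸ m → m % d ≡ n % d
  d∣n∸m⇒m%d≡n%d {m} {n} m≤n (divides q n∸m≡q*d) = begin
    m % d              ≡⟨ [m+kn]%n≡m%n m q d ⟨
    (m + q * d) % d    ≡⟨ cong (λ k → (m + k) % d) n∸m≡q*d ⟨
    (m + (n ∸ m)) % d  ≡⟨ cong (_% d) (m+[n∸m]≡n m≤n) ⟩
    n % d              ∎
    where open ≡-Reasoning

k^n≡k^m*k^[n∸m] : ∀ k {m n} → m ≤ n → k ^ n ≡ k ^ m * k ^ (n ∸ m)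
k^n≡k^m*k^[n∸m] k {m} m≤n = trans (cong (k ^_) (sym (m+[n∸m]≡n m≤n))) (^-distribˡ-+-* k m _)

d∣m∧0<m<d+d⇒m≡d : ∀ {d m} → d ∣ m → 0 < m → m < d + d → m ≡ d
d∣m∧0<m<d+d⇒m≡d {d} (divides zero          refl) ()
d∣m∧0<m<d+d⇒m≡d {d} (divides (suc zero)    refl) _ _   = +-identityʳ d
d∣m∧0<m<d+d⇒m≡d {d} (divides (suc (suc q)) refl) _ m<d+d =
  contradiction (+-monoʳ-≤ d (m≤m+n d (q * d))) (<⇒≱ m<d+d)

n≤2^⌈log₂n⌉ : ∀ n → n ≤ 2 ^ ⌈log₂ n ⌉
n≤2^⌈log₂n⌉ = <-rec (λ n → n ≤ 2 ^ ⌈log₂ n ⌉) step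
  where
  step : ∀ n → (∀ {k} → k < n → k ≤ 2 ^ ⌈log₂ k ⌉) → n ≤ 2 ^ ⌈log₂ n ⌉
  step zero          _   = z≤n
  step (suc zero)    _   = s≤s z≤n
  step n@(suc (suc k)) rec = begin
    n                          ≡⟨ ⌊n/2⌋+⌈n/2⌉≡n n ⟨
    ⌊ n /2⌋ + ⌈ n /2⌉          ≤⟨ +-monoˡ-≤ ⌈ n /2⌉ (⌊n/2⌋≤⌈n/2⌉ n) ⟩
    ⌈ n /2⌉ + ⌈ n /2⌉          ≤⟨ +-mono-≤ half≤ half≤ ⟩
    2 ^ ℓ + 2 ^ ℓ              ≡⟨ cong (2 ^ ℓ +_) (+-identityʳ (2 ^ ℓ)) ⟨
    2 ^ suc ℓ                  ≡⟨ cong (λ j → 2 ^ suc j) (⌈log₂⌈n/2⌉⌉≡⌈log₂n⌉∸1 n) ⟩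
    2 ^ suc (⌈log₂ n ⌉ ∸ 1)    ≡⟨ cong (2 ^_) (m+[n∸m]≡n (⌈log₂⌉-mono-≤ {2} {n} (s≤s (s≤s z≤n)))) ⟩
    2 ^ ⌈log₂ n ⌉              ∎
    where
    open ≤-Reasoning
    ℓ = ⌈log₂ ⌈ n /2⌉ ⌉
    half≤ : ⌈ n /2⌉ ≤ 2 ^ ℓ
    half≤ = rec (s≤s (⌊n/2⌋<n k))

length-oddsBelow : ∀ k → length (oddsBelow (2 * k)) ≡ k
length-oddsBelow zero    = refl
length-oddsBelow (suc k) = begin
  length (filter odd? (upTo (2 * suc k)))                    ≡⟨ cong (λ n → length (filter odd? (upTo n))) (*-suc 2 k) ⟩
  length (filter odd? (upTo (suc (suc (2 * k)))))            ≡⟨ snoc (suc (2 * k)) ⟩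
  length (filter odd? (upTo (suc (2 * k)))) + length (filter odd? (suc (2 * k) ∷ []))
    ≡⟨ cong₂ _+_ (snoc (2 * k)) (cong length (filter-accept odd? {x = suc (2 * k)} {xs = []} 1+2k-odd)) ⟩
  length (oddsBelow (2 * k)) + length (filter odd? (2 * k ∷ [])) + 1
    ≡⟨ cong (λ p → length (oddsBelow (2 * k)) + p + 1) (cong length (filter-reject odd? {x = 2 * k} {xs = []} 2k-not-odd)) ⟩
  length (oddsBelow (2 * k)) + 0 + 1                         ≡⟨ cong (λ p → p + 0 + 1) (length-oddsBelow k) ⟩
  k + 0 + 1                                                  ≡⟨ trans (cong (_+ 1) (+-identityʳ k)) (+-comm k 1) ⟩
  suc k                                                      ∎
  where
  open ≡-Reasoning
  odd? : ∀ a → Dec (Odd a)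
  odd? a = a % 2 ≟ 1
  snoc : ∀ n → length (filter odd? (upTo (suc n))) ≡ length (filter odd? (upTo n)) + length (filter odd? (n ∷ []))
  snoc n = trans (cong (λ l → length (filter odd? l)) (sym (upTo-∷ʳ n)))
                 (trans (cong length (filter-++ odd? (upTo n) (n ∷ []))) (length-++ (filter odd? (upTo n))))
  1+2k-odd : Odd (suc (2 * k))
  1+2k-odd = trans (cong (λ p → suc p % 2) (*-comm 2 k)) ([m+kn]%n≡m%n 1 k 2)
  2k-not-odd : ¬ Odd (2 * k)
  2k-not-odd 2k-odd with trans (sym (trans (cong (_% 2) (*-comm 2 k)) (m*n%n≡0 k 2))) 2k-odd
  ... | ()

module _ {A : Set} where

  length-filter-mono : ∀ {P Q : A → Set} (P? : Decidable P) (Q? : Decidable Q) →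
                       (∀ {a} → P a → Q a) → ∀ l → length (filter P? l) ≤ length (filter Q? l)
  length-filter-mono P? Q? P⇒Q l = length-mono-≤ (filter⁺ P? Q? (λ { refl → P⇒Q }) (⊆-refl {x = l}))

  indicator : {P : A → Set} → Decidable P → A → ℕ
  indicator P? a = if does (P? a) then 1 else 0

  length-filter≡sum-indicator : ∀ {P : A → Set} (P? : Decidable P) l →
                                length (filter P? l) ≡ sum (map (indicator P?) l)
  length-filter≡sum-indicator P? []      = refl
  length-filter≡sum-indicator P? (a ∷ l) with does (P? a)
  ... | true  = cong suc (length-filter≡sum-indicator P? l)
  ... | false = length-filter≡sum-indicator P? l

  length-filter*≤sum : ∀ {Q : A → Set} (Q? : Decidable Q) (f : A → ℕ) {k} →
                       (∀ {a} → Q a → k ≤ f a) → ∀ l → length (filter Q? l) * k ≤ sum (map f l)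
  length-filter*≤sum Q? f k≤f []      = z≤n
  length-filter*≤sum Q? f k≤f (a ∷ l) with Q? a
  ... | yes qa = +-mono-≤ (k≤f qa) (length-filter*≤sum Q? f k≤f l)
  ... | no  _  = ≤-trans (length-filter*≤sum Q? f k≤f l) (m≤n+m _ (f a))

  sum-map-≤ : ∀ (f : A → ℕ) {k} l → (∀ {a} → a ∈ l → f a ≤ k) → sum (map f l) ≤ length l * k
  sum-map-≤ f []      f≤k = z≤n
  sum-map-≤ f (a ∷ l) f≤k = +-mono-≤ (f≤k (here refl)) (sum-map-≤ f l (f≤k ∘ there))

  sum-map-+ : ∀ (f g : A → ℕ) l → sum (map (λ a → f a + g a) l) ≡ sum (map f l) + sum (map g l)
  sum-map-+ f g []      = refl
  sum-map-+ f g (a ∷ l) = trans (cong (f a + g a +_) (sum-map-+ f g l)) (+-interchange (f a) (g a) _ _)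

  sum-map-const : ∀ k (l : List A) → sum (map (λ _ → k) l) ≡ length l * k
  sum-map-const k []      = refl
  sum-map-const k (a ∷ l) = cong (k +_) (sum-map-const k l)

  sum-map-*ˡ : ∀ k (f : A → ℕ) l → sum (map (λ a → k * f a) l) ≡ k * sum (map f l)
  sum-map-*ˡ k f []      = sym (*-zeroʳ k)
  sum-map-*ˡ k f (a ∷ l) = trans (cong (k * f a +_) (sum-map-*ˡ k f l)) (sym (*-distribˡ-+ k (f a) _))

  sum-map-*ʳ : ∀ k (f : A → ℕ) l → sum (map (λ a → f a * k) l) ≡ sum (map f l) * k
  sum-map-*ʳ k f []      = refl
  sum-map-*ʳ k f (a ∷ l) = trans (cong (f a * k +_) (sum-map-*ʳ k f l)) (sym (*-distribʳ-+ k (f a) _))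

module _ {A B : Set} where

  sum-swap : ∀ (f : A → B → ℕ) xs ys →
             sum (map (λ a → sum (map (f a) ys)) xs) ≡ sum (map (λ b → sum (map (λ a → f a b) xs)) ys)
  sum-swap f []       ys = sym (trans (sum-map-const 0 ys) (*-zeroʳ (length ys)))
  sum-swap f (a ∷ xs) ys = trans (cong (sum (map (f a) ys) +_) (sum-swap f xs ys))
                                 (sym (sum-map-+ (f a) (λ b → sum (map (λ a → f a b) xs)) ys))

  sum-map-concatMap : ∀ (f : B → ℕ) (g : A → List B) xs →
                      sum (map f (concatMap g xs)) ≡ sum (map (λ a → sum (map f (g a))) xs)
  sum-map-concatMap f g []       = refl
  sum-map-concatMap f g (a ∷ xs) = begin
    sum (map f (g a ++ concatMap g xs))                   ≡⟨ cong sum (map-++ f (g a) _) ⟩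
    sum (map f (g a) ++ map f (concatMap g xs))           ≡⟨ sum-++ (map f (g a)) _ ⟩
    sum (map f (g a)) + sum (map f (concatMap g xs))      ≡⟨ cong (sum (map f (g a)) +_) (sum-map-concatMap f g xs) ⟩
    sum (map f (g a)) + sum (map (λ a → sum (map f (g a))) xs) ∎
    where open ≡-Reasoning

sum-map-tuples : ∀ (W : List ℕ → ℕ) (f : ℕ → ℕ) → W [] ≡ 1 → (∀ a t → W (a ∷ t) ≡ f a * W t) →
                 ∀ L S → sum (map W (tuples L S)) ≡ sum (map f S) ^ L
sum-map-tuples W f W[]≡1 W-∷ zero    S = cong (_+ 0) W[]≡1
sum-map-tuples W f W[]≡1 W-∷ (suc L) S = begin
  sum (map W (concatMap (λ a → map (a ∷_) (tuples L S)) S))  ≡⟨ sum-map-concatMap W (λ a → map (a ∷_) (tuples L S)) S ⟩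
  sum (map (λ a → sum (map W (map (a ∷_) (tuples L S)))) S)  ≡⟨ cong sum (map-cong prepend S) ⟩
  sum (map (λ a → f a * sum (map W (tuples L S))) S)          ≡⟨ sum-map-*ʳ _ f S ⟩
  sum (map f S) * sum (map W (tuples L S))                    ≡⟨ cong (sum (map f S) *_) (sum-map-tuples W f W[]≡1 W-∷ L S) ⟩
  sum (map f S) * sum (map f S) ^ L                           ∎
  where
  open ≡-Reasoning
  prepend : ∀ a → sum (map W (map (a ∷_) (tuples L S))) ≡ f a * sum (map W (tuples L S))
  prepend a = begin
    sum (map W (map (a ∷_) (tuples L S)))  ≡⟨ cong sum (map-∘ (tuples L S)) ⟨
    sum (map (λ t → W (a ∷ t)) (tuples L S)) ≡⟨ cong sum (map-cong (W-∷ a) (tuples L S)) ⟩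
    sum (map (λ t → f a * W t) (tuples L S)) ≡⟨ sum-map-*ˡ (f a) W (tuples L S) ⟩
    f a * sum (map W (tuples L S))         ∎

length-tuples : ∀ L (S : List ℕ) → length (tuples L S) ≡ length S ^ L
length-tuples L S = begin
  length (tuples L S)              ≡⟨ trans (sym (*-identityʳ _)) (sym (sum-map-const 1 (tuples L S))) ⟩
  sum (map (λ _ → 1) (tuples L S)) ≡⟨ sum-map-tuples (λ _ → 1) (λ _ → 1) refl (λ _ _ → refl) L S ⟩
  sum (map (λ _ → 1) S) ^ L        ≡⟨ cong (_^ L) (trans (sum-map-const 1 S) (*-identityʳ _)) ⟩
  length S ^ L                     ∎
  where open ≡-Reasoning

remove : ℕ → List ℕ → List ℕ
remove x = filter (λ y → ¬? (y ≟ x))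

length-remove< : ∀ {x l} → x ∈ l → length (remove x l) < length l
length-remove< {x} {l} x∈l = filter-notAll (λ y → ¬? (y ≟ x)) l (Any.map (λ x≡y y≢x → y≢x (sym x≡y)) x∈l)

length-filter≤1+length-filter-remove : ∀ {P : ℕ → Set} (P? : Decidable P) x {l} → Unique l →
                                       length (filter P? l) ≤ suc (length (filter P? (remove x l)))
length-filter≤1+length-filter-remove P? x {[]}    []           = z≤n
length-filter≤1+length-filter-remove P? x {a ∷ l} (a∉l ∷ uniq) with a ≟ x
... | yes refl rewrite filter-reject (λ y → ¬? (y ≟ a)) {xs = l} (λ a≢a → a≢a refl)
                     | filter-all (λ y → ¬? (y ≟ a)) (All.map (λ a≢y y≡a → a≢y (sym y≡a)) a∉l)
  with does (P? a)
... | true  = ≤-refl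
... | false = n≤1+n _
length-filter≤1+length-filter-remove P? x {a ∷ l} (_ ∷ uniq) | no a≢x
  rewrite filter-accept (λ y → ¬? (y ≟ x)) {xs = l} a≢x with does (P? a)
... | true  = s≤s (length-filter≤1+length-filter-remove P? x uniq)
... | false = length-filter≤1+length-filter-remove P? x uniq

Unique∧All<⇒length≤ : ∀ n {l} → Unique l → All (_< n) l → length l ≤ n
Unique∧All<⇒length≤ zero    {[]}    _    _          = z≤n
Unique∧All<⇒length≤ zero    {_ ∷ _} _    (() ∷ _)
Unique∧All<⇒length≤ (suc n) {l}     uniq all<1+n = begin
  length l                                            ≡⟨ cong length (filter-all (_<? suc n) all<1+n) ⟨
  length (filter (_<? suc n) l)                       ≤⟨ length-filter≤1+length-filter-remove (_<? suc n) n uniq ⟩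
  suc (length (filter (_<? suc n) (remove n l)))      ≤⟨ s≤s (length-filter (_<? suc n) (remove n l)) ⟩
  suc (length (remove n l))                           ≤⟨ s≤s (Unique∧All<⇒length≤ n (Unique.filter⁺ _ uniq) (all<n l all<1+n)) ⟩
  suc n                                               ∎
  where
  open ≤-Reasoning
  all<n : ∀ l → All (_< suc n) l → All (_< n) (remove n l)
  all<n l all<1+n = All.zipWith (λ (a<1+n , a≢n) → ≤∧≢⇒< (≤-pred a<1+n) a≢n)
                      (All.filter⁺ _ all<1+n , All.all-filter _ l)

module _ {A : Set} {P : A → Set} (f : A → ℕ) (f-inj : ∀ {a b} → P a → P b → f a ≡ f b → a ≡ b) where

  Unique-map⁺ : ∀ {l} → Unique l → All P l → Unique (map f l)
  Unique-map⁺ {[]}    []           []         = []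
  Unique-map⁺ {a ∷ l} (a∉l ∷ uniq) (pa ∷ ps) = distinct a∉l ps ∷ Unique-map⁺ uniq ps
    where
    distinct : ∀ {l} → All (a ≢_) l → All P l → All (f a ≢_) (map f l)
    distinct []            []         = []
    distinct (a≢b ∷ a∉l) (pb ∷ ps) = (a≢b ∘ f-inj pa pb) ∷ distinct a∉l ps

  length≤-by-injection : ∀ n {l} → Unique l → All P l → (∀ {a} → P a → f a < n) → length l ≤ n
  length≤-by-injection n {l} uniq ps f<n = subst (_≤ n) (length-map f l)
    (Unique∧All<⇒length≤ n (Unique-map⁺ uniq ps) (All.map⁺ (All.map f<n ps)))

module _ {A : Set} {P : A → Set} (P? : Decidable P) where

  length-filter-∷ : ∀ a l → length (filter P? (a ∷ l)) ≡ indicator P? a + length (filter P? l)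
  length-filter-∷ a l with does (P? a)
  ... | true  = refl
  ... | false = refl

  sum-map-2^indicator : ∀ l → sum (map (λ a → 2 ^ indicator P? a) l) ≡ length l + length (filter P? l)
  sum-map-2^indicator []      = refl
  sum-map-2^indicator (a ∷ l) with does (P? a)
  ... | true  = cong suc (trans (cong suc (sum-map-2^indicator l)) (sym (+-suc (length l) _)))
  ... | false = cong suc (sum-map-2^indicator l)

-- 2-universality of multiplicative hashing

Unique-oddsBelow : ∀ u → Unique (oddsBelow u)
Unique-oddsBelow u = Unique.filter⁺ (λ a → a % 2 ≟ 1) (Unique.upTo⁺ u)

∈-oddsBelow⁻ : ∀ {u a} → a ∈ oddsBelow u → a < u × Odd a
∈-oddsBelow⁻ {u} a∈odds with a∈upTo , odd-a ← ∈-filter⁻ (λ a → a % 2 ≟ 1) {xs = upTo u} a∈odds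
  = ∈-upTo⁻ a∈upTo , odd-a

-- h_a(y) with u = 2^w and u/m = 2^b
hash : (w b a y : ℕ) → ℕ
hash w b a y = _/_ (_%_ (a * y) (2 ^ w) {{m^n≢0 2 w}}) (2 ^ b) {{m^n≢0 2 b}}

Collision-count : (w b x y : ℕ) → ℕ
Collision-count w b x y = length (filter (λ a → hash w b a y ≟ hash w b a x) (oddsBelow (2 ^ w)))

module Collisions {w b s o x y : ℕ} (b<w : b < w) (x<y : x < y) (y<2^w : y < 2 ^ w)
                  (odd-o : Odd o) (s<w : s < w) (y∸x≡2^s*o : y ∸ x ≡ 2 ^ s * o) where

  u = 2 ^ w
  B = 2 ^ b
  M = 2 ^ (w ∸ s)
  z = y ∸ x

  private instance
    u≢0 : NonZero u
    u≢0 = m^n≢0 2 w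
    B≢0 : NonZero B
    B≢0 = m^n≢0 2 b
    M≢0 : NonZero M
    M≢0 = m^n≢0 2 (w ∸ s)
    2^s≢0 : NonZero (2 ^ s)
    2^s≢0 = m^n≢0 2 s

  Collide : ℕ → Set
  Collide a = hash w b a y ≡ hash w b a x

  collide? : ∀ a → Dec (Collide a)
  collide? a = hash w b a y ≟ hash w b a x

  B+B≤u : B + B ≤ u
  B+B≤u = subst (λ k → B + k ≤ u) (+-identityʳ B) (^-monoʳ-≤ 2 b<w)

  u≡2^s*M : u ≡ 2 ^ s * M
  u≡2^s*M = k^n≡k^m*k^[n∸m] 2 (<⇒≤ s<w)

  a*z≡2^s*[a*o] : ∀ a → a * z ≡ 2 ^ s * (a * o)
  a*z≡2^s*[a*o] a = trans (cong (a *_) y∸x≡2^s*o) (*-x∙yz≈y∙xz a (2 ^ s) o)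

  -- If a x and a y collide then e a = (a y mod u) - (a x mod u) + B, so 0 < e a < 2B.
  e : ℕ → ℕ
  e a = (a * z + B) % u

  module _ (a : ℕ) (collide : Collide a) where

    private
      X = a * x % u
      Y = a * y % u

    X<Y+B : X < Y + B
    X<Y+B = m/d≡n/d⇒m<n+d (sym collide)

    m+X≡Y+B⇒m<B+B : ∀ {m} → m + X ≡ Y + B → m < B + B
    m+X≡Y+B⇒m<B+B {m} m+X≡Y+B = +-cancelʳ-< X m (B + B) (begin-strict
      m + X      ≡⟨ m+X≡Y+B ⟩
      Y + B      <⟨ +-monoˡ-< B (m/d≡n/d⇒m<n+d collide) ⟩
      X + B + B  ≡⟨ +-assoc X B B ⟩
      X + (B + B) ≡⟨ +-comm X (B + B) ⟩
      B + B + X  ∎)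
      where open ≤-Reasoning

    e+X≡Y+B : e a + X ≡ Y + B
    e+X≡Y+B = trans (cong (_+ X) e≡E) E+X≡Y+B
      where
      open ≡-Reasoning
      E = Y + B ∸ X
      E+X≡Y+B : E + X ≡ Y + B
      E+X≡Y+B = m∸n+n≡m (<⇒≤ X<Y+B)
      [X+az+B]%u≡[X+E]%u : (X + (a * z + B)) % u ≡ (X + E) % u
      [X+az+B]%u≡[X+E]%u = begin
        (X + (a * z + B)) % u      ≡⟨ [m%d+n]%d≡[m+n]%d (a * x) _ ⟩
        (a * x + (a * z + B)) % u  ≡⟨ cong (_% u) (+-assoc (a * x) (a * z) B) ⟨
        (a * x + a * z + B) % u    ≡⟨ cong (λ k → (k + B) % u) (trans (sym (*-distribˡ-+ a x z)) (cong (a *_) (m+[n∸m]≡n (<⇒≤ x<y)))) ⟩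
        (a * y + B) % u            ≡⟨ [m%d+n]%d≡[m+n]%d (a * y) B ⟨
        (Y + B) % u                ≡⟨ cong (_% u) (trans (sym E+X≡Y+B) (+-comm E X)) ⟩
        (X + E) % u                ∎
      e≡E : e a ≡ E
      e≡E = trans ([m+n]%d≡[m+o]%d⇒n%d≡o%d (m%n<n (a * x) u) [X+az+B]%u≡[X+E]%u)
                  (m<n⇒m%n≡m (<-≤-trans (m+X≡Y+B⇒m<B+B E+X≡Y+B) B+B≤u))

    0<e : 0 < e a
    0<e = +-cancelʳ-< X 0 (e a) (subst (X <_) (sym e+X≡Y+B) X<Y+B)

    e<B+B : e a < B + B
    e<B+B = m+X≡Y+B⇒m<B+B e+X≡Y+B

  e≡e⇒a%M≡a′%M : ∀ {a a′} → e a ≡ e a′ → a % M ≡ a′ % M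
  e≡e⇒a%M≡a′%M {a} {a′} e≡e = [ ordered e≡e , (λ a′≤a → sym (ordered (sym e≡e) a′≤a)) ]′ (≤-total a a′)
    where
    ordered : ∀ {a a′} → e a ≡ e a′ → a ≤ a′ → a % M ≡ a′ % M
    ordered {a} {a′} e≡e a≤a′ = d∣n∸m⇒m%d≡n%d a≤a′
      (2^r∣m*odd⇒2^r∣m (w ∸ s) (a′ ∸ a) odd-o (*-cancelˡ-∣ (2 ^ s) (subst₂ _∣_ u≡2^s*M diff≡ u∣diff)))
      where
      u∣diff : u ∣ (a′ * z + B) ∸ (a * z + B)
      u∣diff = m%d≡n%d⇒d∣n∸m (+-monoˡ-≤ B (*-monoˡ-≤ z a≤a′)) e≡e
      diff≡ : (a′ * z + B) ∸ (a * z + B) ≡ 2 ^ s * ((a′ ∸ a) * o)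
      diff≡ = begin
        (a′ * z + B) ∸ (a * z + B)  ≡⟨ cong₂ _∸_ (+-comm (a′ * z) B) (+-comm (a * z) B) ⟩
        (B + a′ * z) ∸ (B + a * z)  ≡⟨ [m+n]∸[m+o]≡n∸o B (a′ * z) (a * z) ⟩
        a′ * z ∸ a * z              ≡⟨ *-distribʳ-∸ z a′ a ⟨
        (a′ ∸ a) * z                ≡⟨ a*z≡2^s*[a*o] (a′ ∸ a) ⟩
        2 ^ s * ((a′ ∸ a) * o)      ∎
        where open ≡-Reasoning

  b≤s⇒¬Collide : b ≤ s → ∀ a → Odd a → ¬ Collide a
  b≤s⇒¬Collide b≤s a odd-a collide = Odd⇒2∤ (Odd-* {a} odd-a odd-o) (∣-trans 2∣M M∣a*o)
    where
    B∣a*z : B ∣ a * z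
    B∣a*z = subst (B ∣_) (sym (trans (a*z≡2^s*[a*o] a) (cong (_* (a * o)) (k^n≡k^m*k^[n∸m] 2 b≤s))))
                  (∣m⇒∣m*n (a * o) (m∣m*n (2 ^ (s ∸ b))))
    B∣u : B ∣ u
    B∣u = divides (2 ^ (w ∸ b)) (trans (k^n≡k^m*k^[n∸m] 2 (<⇒≤ b<w)) (*-comm B _))
    e≡B : e a ≡ B
    e≡B = d∣m∧0<m<d+d⇒m≡d (%-presˡ-∣ (∣m∣n⇒∣m+n B∣a*z ∣-refl) B∣u) (0<e a collide) (e<B+B a collide)
    u∣a*z : u ∣ a * z
    u∣a*z = subst (u ∣_) (m+n∸n≡m (a * z) B)
                  (m%d≡n%d⇒d∣n∸m (m≤n+m B (a * z)) (trans (m<n⇒m%n≡m (<-≤-trans (m<m+n B (m^n>0 2 b)) B+B≤u)) (sym e≡B)))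
    M∣a*o : M ∣ a * o
    M∣a*o = *-cancelˡ-∣ (2 ^ s) (subst₂ _∣_ u≡2^s*M (a*z≡2^s*[a*o] a) u∣a*z)
    2∣M : 2 ∣ M
    2∣M = subst (2 ∣_) (sym (k^n≡k^m*k^[n∸m] 2 (m<n⇒0<n∸m s<w))) (m∣m*n (2 ^ (w ∸ s ∸ 1)))

  -- For s < b, the residue e a mod 2^(s+1) is always 2^s, e a determines a mod M, and a / M < 2^s;
  -- so the collisions inject into [B] via the mixed-radix code below.
  module _ (s<b : s < b) where

    private
      S = 2 ^ suc s
      G = 2 ^ (b ∸ s)
      instance
        S≢0 : NonZero S
        S≢0 = m^n≢0 2 (suc s)

    e%S≡2^s : ∀ a → Odd a → e a % S ≡ 2 ^ s
    e%S≡2^s a odd-a = begin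
      (a * z + B) % u % S         ≡⟨ m∣n⇒o%n%m≡o%m S u (a * z + B) S∣u ⟩
      (a * z + B) % S             ≡⟨ cong (_% S) a*z+B≡ ⟩
      (2 ^ s + q * S) % S         ≡⟨ [m+kn]%n≡m%n (2 ^ s) q S ⟩
      2 ^ s % S                   ≡⟨ m<n⇒m%n≡m (m<m+n (2 ^ s) (subst (0 <_) (sym (+-identityʳ _)) (m^n>0 2 s))) ⟩
      2 ^ s                       ∎
      where
      open ≡-Reasoning
      S∣u : S ∣ u
      S∣u = divides (2 ^ (w ∸ suc s)) (trans (k^n≡k^m*k^[n∸m] 2 s<w) (*-comm S _))
      half = (a * o) / 2
      q = half + 2 ^ (b ∸ suc s)
      a*z+B≡ : a * z + B ≡ 2 ^ s + q * S
      a*z+B≡ = begin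
        a * z + B                                   ≡⟨ cong₂ _+_ (a*z≡2^s*[a*o] a) (k^n≡k^m*k^[n∸m] 2 s<b) ⟩
        2 ^ s * (a * o) + S * 2 ^ (b ∸ suc s)       ≡⟨ cong (λ k → 2 ^ s * k + S * 2 ^ (b ∸ suc s)) (m≡m%n+[m/n]*n (a * o) 2) ⟩
        2 ^ s * (a * o % 2 + half * 2) + S * 2 ^ (b ∸ suc s) ≡⟨ cong (λ k → 2 ^ s * (k + half * 2) + S * 2 ^ (b ∸ suc s)) (Odd-* {a} odd-a odd-o) ⟩
        2 ^ s * (1 + half * 2) + 2 * 2 ^ s * 2 ^ (b ∸ suc s) ≡⟨ regroup (2 ^ s) half (2 ^ (b ∸ suc s)) ⟩
        2 ^ s + q * S                               ∎
        where
        regroup : ∀ p h g → p * (1 + h * 2) + 2 * p * g ≡ p + (h + g) * (2 * p)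
        regroup = solve-∀

    code : ℕ → ℕ
    code a = e a / S * 2 ^ s + a / M

    a/M<2^s : ∀ {a} → a < u → a / M < 2 ^ s
    a/M<2^s a<u = m<n*o⇒m/o<n (subst (_ <_) u≡2^s*M a<u)

    B+B≡G*S : B + B ≡ G * S
    B+B≡G*S = trans (cong (λ k → k + k) (k^n≡k^m*k^[n∸m] 2 (<⇒≤ s<b))) (double (2 ^ s) G)
      where
      double : ∀ p g → p * g + p * g ≡ g * (2 * p)
      double = solve-∀

    code<B : ∀ a → a < u → Collide a → code a < B
    code<B a a<u collide = begin-strict
      e a / S * 2 ^ s + a / M   <⟨ +-monoʳ-< (e a / S * 2 ^ s) (a/M<2^s a<u) ⟩
      e a / S * 2 ^ s + 2 ^ s   ≡⟨ +-comm (e a / S * 2 ^ s) (2 ^ s) ⟩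
      suc (e a / S) * 2 ^ s     ≤⟨ *-monoˡ-≤ (2 ^ s) e/S<G ⟩
      G * 2 ^ s                 ≡⟨ trans (*-comm G (2 ^ s)) (sym (k^n≡k^m*k^[n∸m] 2 (<⇒≤ s<b))) ⟩
      B                         ∎
      where
      open ≤-Reasoning
      e/S<G : e a / S < G
      e/S<G = m<n*o⇒m/o<n (subst (e a <_) B+B≡G*S (e<B+B a collide))

    e≡e/S*S+2^s : ∀ a → Odd a → e a ≡ e a / S * S + 2 ^ s
    e≡e/S*S+2^s a odd-a = trans (m≡m%n+[m/n]*n (e a) S) (trans (cong (_+ e a / S * S) (e%S≡2^s a odd-a)) (+-comm (2 ^ s) _))

    code-injective : ∀ {a a′} → Odd a → a < u → Odd a′ → a′ < u → code a ≡ code a′ → a ≡ a′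
    code-injective {a} {a′} odd-a a<u odd-a′ a′<u code≡ = begin
      a                   ≡⟨ m≡m%n+[m/n]*n a M ⟩
      a % M + a / M * M   ≡⟨ cong₂ (λ r q → r + q * M) (e≡e⇒a%M≡a′%M {a} {a′} e≡e) a/M≡a′/M ⟩
      a′ % M + a′ / M * M ≡⟨ m≡m%n+[m/n]*n a′ M ⟨
      a′                  ∎
      where
      open ≡-Reasoning
      a/M≡a′/M : a / M ≡ a′ / M
      a/M≡a′/M = trans (sym ([q*d+r]%d≡r (e a / S) (a/M<2^s a<u)))
                       (trans (cong (_% 2 ^ s) code≡) ([q*d+r]%d≡r (e a′ / S) (a/M<2^s a′<u)))
      e/S≡e′/S : e a / S ≡ e a′ / S
      e/S≡e′/S = trans (sym ([q*d+r]/d≡q (e a / S) (a/M<2^s a<u)))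
                       (trans (cong (_/ 2 ^ s) code≡) ([q*d+r]/d≡q (e a′ / S) (a/M<2^s a′<u)))
      e≡e : e a ≡ e a′
      e≡e = trans (e≡e/S*S+2^s a odd-a) (trans (cong (λ k → k * S + 2 ^ s) e/S≡e′/S) (sym (e≡e/S*S+2^s a′ odd-a′)))

  count-≤ : Collision-count w b x y ≤ B
  count-≤ with s <? b
  ... | yes s<b = length≤-by-injection (code s<b) injective B (Unique.filter⁺ collide? (Unique-oddsBelow u)) candidates bounded
    where
    Candidate : ℕ → Set
    Candidate a = (a < u × Odd a) × Collide a
    candidates : All Candidate (filter collide? (oddsBelow u))
    candidates = All.tabulate λ a∈ → let a∈odds , collide = ∈-filter⁻ collide? {xs = oddsBelow u} a∈
                                     in ∈-oddsBelow⁻ {u} a∈odds , collide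
    injective : ∀ {a a′} → Candidate a → Candidate a′ → code s<b a ≡ code s<b a′ → a ≡ a′
    injective ((a<u , odd-a) , _) ((a′<u , odd-a′) , _) = code-injective s<b odd-a a<u odd-a′ a′<u
    bounded : ∀ {a} → Candidate a → code s<b a < B
    bounded {a} ((a<u , _) , collide) = code<B s<b a a<u collide
  ... | no s≮b = subst (λ l → length l ≤ B) (sym (filter-none collide? none)) z≤n
    where
    none : All (¬_ ∘ Collide) (oddsBelow u)
    none = All.tabulate λ {a} a∈ → b≤s⇒¬Collide (≮⇒≥ s≮b) a (proj₂ (∈-oddsBelow⁻ {u} a∈))

collisions-≤-ordered : ∀ {w b x y} → b < w → x < y → y < 2 ^ w → Collision-count w b x y ≤ 2 ^ b
collisions-≤-ordered {w} {b} {x} {y} b<w x<y y<2^w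
  with odd-part w (y ∸ x) (m<n⇒0<n∸m x<y) (≤-<-trans (m∸n≤m y x) y<2^w)
... | s , o , odd-o , s<w , y∸x≡2^s*o = Collisions.count-≤ b<w x<y y<2^w odd-o s<w y∸x≡2^s*o

collisions-≤ : ∀ {w b x y} → x ≢ y → x < 2 ^ w → y < 2 ^ w → Collision-count w b x y ≤ 2 ^ b
collisions-≤ {w} {b} {x} {y} x≢y x<2^w y<2^w with b <? w
... | no b≮w = begin
  Collision-count w b x y    ≤⟨ length-filter _ (oddsBelow (2 ^ w)) ⟩
  length (oddsBelow (2 ^ w)) ≤⟨ length-filter _ (upTo (2 ^ w)) ⟩
  length (upTo (2 ^ w))      ≡⟨ length-upTo (2 ^ w) ⟩
  2 ^ w                      ≤⟨ ^-monoʳ-≤ 2 (≮⇒≥ b≮w) ⟩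
  2 ^ b                      ∎
  where open ≤-Reasoning
... | yes b<w with <-cmp x y
... | tri< x<y _ _ = collisions-≤-ordered b<w x<y y<2^w
... | tri≈ _ x≡y _ = contradiction x≡y x≢y
... | tri> _ _ y<x = ≤-trans (length-filter-mono _ _ sym (oddsBelow (2 ^ w))) (collisions-≤-ordered b<w y<x x<2^w)

hashH≡hash : ∀ {w c} → c ≤ w → ∀ a y → hashH (2 ^ w) (2 ^ c) a y ≡ hash w (w ∸ c) a y
hashH≡hash {w} {c} c≤w a y =
  trans (cong₂ divℕ (modℕ≡% (a * y) (m^n≢0 2 w)) (trans (divℕ≡/ (2 ^ w) (m^n≢0 2 c)) u/m≡2^[w∸c]))
        (divℕ≡/ _ (m^n≢0 2 (w ∸ c)))
  where
  divℕ≡/ : ∀ a {n} (n≢0 : NonZero n) → divℕ a n ≡ _/_ a n {{n≢0}}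
  divℕ≡/ a {suc n} _ = refl
  modℕ≡% : ∀ a {n} (n≢0 : NonZero n) → modℕ a n ≡ _%_ a n {{n≢0}}
  modℕ≡% a {suc n} _ = refl
  u/m≡2^[w∸c] : _/_ (2 ^ w) (2 ^ c) {{m^n≢0 2 c}} ≡ 2 ^ (w ∸ c)
  u/m≡2^[w∸c] = trans (cong (λ k → _/_ k (2 ^ c) {{m^n≢0 2 c}}) (trans (k^n≡k^m*k^[n∸m] 2 c≤w) (*-comm (2 ^ c) _)))
                      (m*n/n≡m (2 ^ (w ∸ c)) (2 ^ c) {{m^n≢0 2 c}})

-- Markov and Chernoff bounds

⌈_/1+_⌉ : ℕ → ℕ → ℕ
⌈ m /1+ n ⌉ = (m + n) / suc n

m≤[1+n]*⌈m/1+n⌉ : ∀ m n → m ≤ suc n * ⌈ m /1+ n ⌉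
m≤[1+n]*⌈m/1+n⌉ m n = +-cancelʳ-≤ n m _ (begin
  m + n                                  ≡⟨ m≡m%n+[m/n]*n (m + n) (suc n) ⟩
  (m + n) % suc n + ⌈ m /1+ n ⌉ * suc n  ≤⟨ +-monoˡ-≤ _ (≤-pred (m%n<n (m + n) (suc n))) ⟩
  n + ⌈ m /1+ n ⌉ * suc n                ≡⟨ trans (+-comm n _) (cong (_+ n) (*-comm _ (suc n))) ⟩
  suc n * ⌈ m /1+ n ⌉ + n                ∎)
  where open ≤-Reasoning

m≤[1+n]*k⇒⌈m/1+n⌉≤k : ∀ {m n k} → m ≤ suc n * k → ⌈ m /1+ n ⌉ ≤ k
m≤[1+n]*k⇒⌈m/1+n⌉≤k {m} {n} {k} m≤[1+n]*k = ≤-pred (m<n*o⇒m/o<n (begin-strict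
  m + n            <⟨ +-monoʳ-< m (n<1+n n) ⟩
  m + suc n        ≤⟨ +-monoˡ-≤ (suc n) m≤[1+n]*k ⟩
  suc n * k + suc n ≡⟨ trans (+-comm (suc n * k) (suc n)) (cong (suc n +_) (*-comm (suc n) k)) ⟩
  suc k * suc n    ∎))
  where open ≤-Reasoning

^-distribʳ-* : ∀ m n k → (m * n) ^ k ≡ m ^ k * n ^ k
^-distribʳ-* m n zero    = refl
^-distribʳ-* m n (suc k) = trans (cong (m * n *_) (^-distribʳ-* m n k)) (*-interchange m n (m ^ k) (n ^ k))
  where
  *-interchange : ∀ a b c d → a * b * (c * d) ≡ a * c * (b * d)
  *-interchange = solve-∀

^-comm : ∀ x m n → (x ^ m) ^ n ≡ (x ^ n) ^ m
^-comm x m n = trans (^-*-assoc x m n) (trans (cong (x ^_) (*-comm m n)) (sym (^-*-assoc x n m)))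

^-cancelʳ-≤ : ∀ n .{{_ : NonZero n}} {x y} → x ^ n ≤ y ^ n → x ≤ y
^-cancelʳ-≤ n {x} {y} x^n≤y^n with x ≤? y
... | yes x≤y = x≤y
... | no  x≰y = contradiction x^n≤y^n (<⇒≱ (^-monoˡ-< n (≰⇒> x≰y)))

-- Raising to the T-th power turns the factor 2^c, where j L ≤ T c, into 2^(j L).
X*d^L≤N^L*a^L : ∀ {X N P a d q T c j L} .{{_ : NonZero T}} → j * L ≤ T * c → X * 2 ^ c ≤ P ^ L →
                d * P ≤ q * N → q ^ T ≤ 2 ^ j * a ^ T → X * d ^ L ≤ N ^ L * a ^ L
X*d^L≤N^L*a^L {X} {N} {P} {a} {d} {q} {T} {c} {j} {L} jL≤Tc X*2^c≤P^L d*P≤q*N q^T≤2^j*a^T =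
  ^-cancelʳ-≤ T (*-cancelʳ-≤ _ _ (2 ^ (j * L)) {{m^n≢0 2 (j * L)}} (begin
  (X * d ^ L) ^ T * 2 ^ (j * L)            ≤⟨ *-monoʳ-≤ ((X * d ^ L) ^ T) (^-monoʳ-≤ 2 jL≤Tc) ⟩
  (X * d ^ L) ^ T * 2 ^ (T * c)            ≡⟨ cong ((X * d ^ L) ^ T *_) (trans (cong (2 ^_) (*-comm T c)) (sym (^-*-assoc 2 c T))) ⟩
  (X * d ^ L) ^ T * (2 ^ c) ^ T            ≡⟨ ^-distribʳ-* (X * d ^ L) (2 ^ c) T ⟨
  (X * d ^ L * 2 ^ c) ^ T                  ≡⟨ cong (_^ T) (xyz≡xzy X (d ^ L) (2 ^ c)) ⟩
  (X * 2 ^ c * d ^ L) ^ T                  ≤⟨ ^-monoˡ-≤ T (*-monoˡ-≤ (d ^ L) X*2^c≤P^L) ⟩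
  (P ^ L * d ^ L) ^ T                      ≡⟨ cong (_^ T) (trans (sym (^-distribʳ-* P d L)) (cong (_^ L) (*-comm P d))) ⟩
  ((d * P) ^ L) ^ T                        ≤⟨ ^-monoˡ-≤ T (^-monoˡ-≤ L d*P≤q*N) ⟩
  ((q * N) ^ L) ^ T                        ≡⟨ trans (^-comm (q * N) L T) (cong (_^ L) (^-distribʳ-* q N T)) ⟩
  (q ^ T * N ^ T) ^ L                      ≤⟨ ^-monoˡ-≤ L (*-monoˡ-≤ (N ^ T) q^T≤2^j*a^T) ⟩
  (2 ^ j * a ^ T * N ^ T) ^ L              ≡⟨ trans (^-distribʳ-* (2 ^ j * a ^ T) (N ^ T) L) (cong (_* (N ^ T) ^ L) (^-distribʳ-* (2 ^ j) (a ^ T) L)) ⟩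
  (2 ^ j) ^ L * (a ^ T) ^ L * (N ^ T) ^ L  ≡⟨ cong₂ _*_ (cong₂ _*_ (^-*-assoc 2 j L) (^-comm a T L)) (^-comm N T L) ⟩
  2 ^ (j * L) * (a ^ L) ^ T * (N ^ L) ^ T  ≡⟨ xyz≡zyx (2 ^ (j * L)) ((a ^ L) ^ T) ((N ^ L) ^ T) ⟩
  (N ^ L) ^ T * (a ^ L) ^ T * 2 ^ (j * L)  ≡⟨ cong (_* 2 ^ (j * L)) (^-distribʳ-* (N ^ L) (a ^ L) T) ⟨
  (N ^ L * a ^ L) ^ T * 2 ^ (j * L)        ∎))
  where
  open ≤-Reasoning
  xyz≡xzy : ∀ x y z → x * y * z ≡ x * z * y
  xyz≡xzy = solve-∀
  xyz≡zyx : ∀ x y z → x * y * z ≡ z * y * x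
  xyz≡zyx = solve-∀

-- Markov's inequality: a discarding h_a puts at least T other elements into the bucket of x,
-- and by 2-universality each other element collides with x under at most u/m multipliers.
discarded*T≤2^w : ∀ {w A x} T → Unique A → All (_< 2 ^ w) A → x ∈ A →
                  length (filter (λ a → T <? bucketSize (2 ^ w) (2 ^ ⌈log₂ length A ⌉) A a x) (oddsBelow (2 ^ w))) * T ≤ 2 ^ w
discarded*T≤2^w {w} {A} {x} T uniq A<2^w x∈A = begin
  length (filter Discards? S) * T           ≤⟨ length-filter*≤sum Discards? others (λ {a} → T≤others {a}) S ⟩
  sum (map others S)                        ≡⟨ cong sum (map-cong (λ a → length-filter≡sum-indicator (collides a) A′) S) ⟩
  sum (map (λ a → sum (map (indicator (collides a)) A′)) S)  ≡⟨ sum-swap (λ a → indicator (collides a)) S A′ ⟩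
  sum (map (λ y → sum (map (λ a → indicator (collides a) y) S)) A′)
    ≡⟨ cong sum (map-cong (λ y → sym (length-filter≡sum-indicator (λ a → hash w b a y ≟ hash w b a x) S)) A′) ⟩
  sum (map (Collision-count w b x) A′)     ≤⟨ sum-map-≤ (Collision-count w b x) A′ collisions ⟩
  length A′ * 2 ^ b                         ≤⟨ *-monoˡ-≤ (2 ^ b) (≤-trans (<⇒≤ (length-remove< x∈A)) (n≤2^⌈log₂n⌉ (length A))) ⟩
  2 ^ c * 2 ^ b                             ≡⟨ k^n≡k^m*k^[n∸m] 2 c≤w ⟨
  2 ^ w                                     ∎
  where
  open ≤-Reasoning
  c = ⌈log₂ length A ⌉
  b = w ∸ c
  S = oddsBelow (2 ^ w)
  A′ = remove x A
  c≤w : c ≤ w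
  c≤w = subst (c ≤_) (⌈log₂2^n⌉≡n w) (⌈log₂⌉-mono-≤ (Unique∧All<⇒length≤ (2 ^ w) uniq A<2^w))
  Discards? : ∀ a → Dec (T < bucketSize (2 ^ w) (2 ^ c) A a x)
  Discards? a = T <? bucketSize (2 ^ w) (2 ^ c) A a x
  collides : ∀ a y → Dec (hash w b a y ≡ hash w b a x)
  collides a y = hash w b a y ≟ hash w b a x
  others : ℕ → ℕ
  others a = length (filter (collides a) A′)
  T≤others : ∀ {a} → T < bucketSize (2 ^ w) (2 ^ c) A a x → T ≤ others a
  T≤others {a} T<bucket = ≤-pred (≤-trans T<bucket (≤-trans
    (length-filter-mono _ (collides a) (λ {y} eq → trans (sym (hashH≡hash c≤w a y)) (trans eq (hashH≡hash c≤w a x))) A)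
    (length-filter≤1+length-filter-remove (collides a) x uniq)))
  collisions : ∀ {y} → y ∈ A′ → Collision-count w b x y ≤ 2 ^ b
  collisions y∈A′ with y∈A , y≢x ← ∈-filter⁻ (λ y → ¬? (y ≟ x)) {xs = A} y∈A′
    = collisions-≤ {w} {b} (y≢x ∘ sym) (All.lookup A<2^w x∈A) (All.lookup A<2^w y∈A)

-- Markov's inequality for 2^(number of entries of the tuple in P), whose sum over all tuples factorises.
exceeding-tuples*2^⌈jL/T⌉≤ : ∀ {P : ℕ → Set} (P? : Decidable P) j T′ L S →
  length (filter (λ t → j * L ≤? suc T′ * length (filter P? t)) (tuples L S)) * 2 ^ ⌈ j * L /1+ T′ ⌉
    ≤ (length S + length (filter P? S)) ^ L
exceeding-tuples*2^⌈jL/T⌉≤ P? j T′ L S = begin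
  length (filter Exceeds? (tuples L S)) * 2 ^ ⌈ j * L /1+ T′ ⌉
    ≤⟨ length-filter*≤sum Exceeds? W (^-monoʳ-≤ 2 ∘ m≤[1+n]*k⇒⌈m/1+n⌉≤k) (tuples L S) ⟩
  sum (map W (tuples L S))                          ≡⟨ sum-map-tuples W (λ a → 2 ^ indicator P? a) refl W-∷ L S ⟩
  sum (map (λ a → 2 ^ indicator P? a) S) ^ L        ≡⟨ cong (_^ L) (sum-map-2^indicator P? S) ⟩
  (length S + length (filter P? S)) ^ L             ∎
  where
  open ≤-Reasoning
  Exceeds? : ∀ t → Dec (j * L ≤ suc T′ * length (filter P? t))
  Exceeds? t = j * L ≤? suc T′ * length (filter P? t)
  W : List ℕ → ℕ
  W t = 2 ^ length (filter P? t)
  W-∷ : ∀ a t → W (a ∷ t) ≡ 2 ^ indicator P? a * W t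
  W-∷ a t = trans (cong (2 ^_) (length-filter-∷ P? a t)) (^-distribˡ-+-* 2 (indicator P? a) _)

3T-2+2≡3T : ∀ T′ → suc (3 * T′) + 2 ≡ 3 * suc T′
3T-2+2≡3T = solve-∀

T*D≤2N⇒3T*[N+D]≤[3T+6]*N : ∀ T′ {N D} → suc T′ * D ≤ 2 * N → 3 * suc T′ * (N + D) ≤ (suc (3 * T′) + 8) * N
T*D≤2N⇒3T*[N+D]≤[3T+6]*N T′ {N} {D} T*D≤2*N = begin
  3 * T * (N + D)            ≡⟨ *-distribˡ-+ (3 * T) N D ⟩
  3 * T * N + 3 * T * D      ≡⟨ cong (3 * T * N +_) (*-assoc 3 T D) ⟩
  3 * T * N + 3 * (T * D)    ≤⟨ +-monoʳ-≤ (3 * T * N) (*-monoʳ-≤ 3 T*D≤2*N) ⟩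
  3 * T * N + 3 * (2 * N)    ≡⟨ ring T′ N ⟩
  (suc (3 * T′) + 8) * N     ∎
  where
  open ≤-Reasoning
  T = suc T′
  ring : ∀ t n → 3 * suc t * n + 3 * (2 * n) ≡ (suc (3 * t) + 8) * n
  ring = solve-∀

lemma1 : (w : ℕ) (A : List ℕ) →
         Unique A → All (λ y → 0 < y × y < 2 ^ w) A →
         (T L : ℕ) → 0 < T → 0 < L →
         (x : ℕ) → x ∈ A →
         ProbLeExpNeg
           (badCount (2 ^ w) (2 ^ ⌈log₂ length A ⌉) T L A x)
           (totalCount (2 ^ w) L)
           (ratℕ (2 * L) (3 * T))
lemma1 w       A uniq bounds zero     L () _ x x∈A
lemma1 zero    A uniq bounds (suc T′) L _ _ x x∈A = contradiction (All.lookup bounds x∈A) λ (0<x , x<1) → <⇒≱ x<1 0<x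
lemma1 (suc w) A uniq bounds (suc T′) L _ _ x x∈A K =
  subst (λ M → ofℕ X ℚ.* expPartial (ratℕ (2 * L) (3 * T)) K ℚ.≤ ofℕ M) (sym (length-tuples L S))
        (X*expPartial[kL/d]≤Y (3T-2+2≡3T T′) X (N ^ L) L chernoff K)
  where
  T = suc T′
  a = suc (3 * T′)
  S = oddsBelow (2 ^ suc w)
  N = length S
  Discards? : ∀ h → Dec (T < bucketSize (2 ^ suc w) (2 ^ ⌈log₂ length A ⌉) A h x)
  Discards? h = T <? bucketSize (2 ^ suc w) (2 ^ ⌈log₂ length A ⌉) A h x
  D = length (filter Discards? S)
  X = badCount (2 ^ suc w) (2 ^ ⌈log₂ length A ⌉) T L A x
  T*D≤2*N : T * D ≤ 2 * N
  T*D≤2*N = subst₂ _≤_ (*-comm D T) (cong (2 *_) (sym (length-oddsBelow (2 ^ w))))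
                       (discarded*T≤2^w {suc w} {A} {x} T uniq (All.map proj₂ bounds) x∈A)
  chernoff : X * (3 * T) ^ L ≤ N ^ L * a ^ L
  chernoff = X*d^L≤N^L*a^L {X} {N} {N + D} {a} {3 * T} {a + 8} {T} {⌈ 4 * L /1+ T′ ⌉} {4} {L}
               (m≤[1+n]*⌈m/1+n⌉ (4 * L) T′)
               (exceeding-tuples*2^⌈jL/T⌉≤ Discards? 4 T′ L S)
               (T*D≤2N⇒3T*[N+D]≤[3T+6]*N T′ T*D≤2*N)
               ([a+8]^T≤16*a^T T′)
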